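{- Let $p$ be an odd prime with $p\neq 3$. (i) If $p\equiv\pm 3\pmod 8$, then the $\overline{2}$-trinomial minimal and the $-\overline{2}$-trinomial minimal solutions of $(E_{\mathbb{Z}/p\mathbb{Z}})$ are irreducible. (ii) If $p=13$ or $p\equiv \pm 2,\pm 5,\pm 6\pmod{13}$, then the $\overline{3}$-trinomial minimal and the $-\overline{3}$-trinomial minimal solutions of $(E_{\mathbb{Z}/p\mathbb{Z}})$ are irreducible. (iii) If $p=5$ or $p\equiv\pm 2\pmod 5$, then the $\overline{4}$-trinomial minimal and the $-\overline{4}$-trinomial minimal solutions of $(E_{\mathbb{Z}/p\mathbb{Z}})$ are irreducible.
   Context: $\overline{a}$ denotes the class of $a$ in $\mathbb{Z}/p\mathbb{Z}$. For a commutative unital ring $A$ and $a_1,\ldots,a_n\in A$ set $M_n(a_1,\ldots,a_n)=\begin{pmatrix} a_n & -1_A\\ 1_A & 0_A\end{pmatrix}\cdots\begin{pmatrix} a_1 & -1_A\\ 1_A & 0_A\end{pmatrix}$. An $n$-tuple is a solution of $(E_A)$ if $M_n(a_1,\ldots,a_n)=\pm \mathrm{Id}$. For tuples, $(a_1,\ldots,a_n)\oplus(b_1,\ldots,b_m)=(a_1+b_m,a_2,\ldots,a_{n-1},a_n+b_1,b_2,\ldots,b_{m-1})$. Write $(a_1,\ldots,a_n)\sim(b_1,\ldots,b_n)$ if $(b_1,\ldots,b_n)$ is obtained from $(a_1,\ldots,a_n)$ or from $(a_n,\ldots,a_1)$ by a cyclic permutation. A solution $(c_1,\ldots,c_n)$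 with $n\geq 3$ is reducible if there exist a solution $(b_1,\ldots,b_l)$ and a tuple $(a_1,\ldots,a_m)$ with $l,m\geq 3$ and $(c_1,\ldots,c_n)\sim(a_1,\ldots,a_m)\oplus(b_1,\ldots,b_l)$; otherwise irreducible. For $A$ finite and $u$ a unit of $A$, the $u$-trinomial minimal solution of $(E_A)$ is the solution of the form $(u,u^{ -1},u^{ -1},\ldots,u,u^{ -1},u^{ -1})$ (block $(u,u^{ -1},u^{ -1})$ repeated $k\geq1$ times) of minimal size. -}

module Defs where

open import Data.Nat as ℕ using (ℕ; zero; suc; _%_)
open import Data.Integer as ℤ using (ℤ; +_; -_; _-_)
open import Data.Integer.Divisibility using (_∣_)
open import Data.List using (List; []; _∷_; _++_; [_]; length; drop; take; reverse; concat; replicate)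
open import Data.List.Relation.Binary.Pointwise using (Pointwise)
open import Data.Product using (Σ; ∃; ∃-syntax; _×_; _,_)
open import Data.Sum using (_⊎_)
open import Relation.Nullary using (¬_)
open import Relation.Binary.PropositionalEquality using (_≡_)

-- Elements of ℤ/pℤ are represented by integers, compared modulo p.
infix 4 _≡[_]_
_≡[_]_ : ℤ → ℕ → ℤ → Set
a ≡[ p ] b = (+ p) ∣ (a - b)

record Mat : Set where
  constructor mat
  field
    m11 m12 m21 m22 : ℤ

_·_ : Mat → Mat → Mat
mat a b c d · mat e f g h =
  mat (a ℤ.* e ℤ.+ b ℤ.* g) (a ℤ.* f ℤ.+ b ℤ.* h)
      (c ℤ.* e ℤ.+ d ℤ.* g) (c ℤ.* f ℤ.+ d ℤ.* h)

Id : Mat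
Id = mat (+ 1) (+ 0) (+ 0) (+ 1)

-Id : Mat
-Id = mat (- + 1) (+ 0) (+ 0) (- + 1)

step : ℤ → Mat
step a = mat a (- + 1) (+ 1) (+ 0)

M : List ℤ → Mat
M [] = Id
M (a ∷ as) = M as · step a

_≈[_]_ : Mat → ℕ → Mat → Set
mat a b c d ≈[ p ] mat e f g h =
  (a ≡[ p ] e) × (b ≡[ p ] f) × (c ≡[ p ] g) × (d ≡[ p ] h)

Solution : ℕ → List ℤ → Set
Solution p as = (M as ≈[ p ] Id) ⊎ (M as ≈[ p ] -Id)

oplus : ℤ → List ℤ → ℤ → ℤ → List ℤ → ℤ → List ℤ
oplus a₁ amid aₘ b₁ bmid bₗ = (a₁ ℤ.+ bₗ) ∷ (amid ++ ((aₘ ℤ.+ b₁) ∷ bmid))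

rotate : ℕ → List ℤ → List ℤ
rotate k xs = drop k xs ++ take k xs

_≋[_]_ : List ℤ → ℕ → List ℤ → Set
xs ≋[ p ] ys = Pointwise (λ x y → x ≡[ p ] y) xs ys

Sim : ℕ → List ℤ → List ℤ → Set
Sim p c d = ∃[ k ] ((rotate k c ≋[ p ] d) ⊎ (rotate k (reverse c) ≋[ p ] d))

-- Reducible solution (n ≥ 3 assumed by the caller):
-- c ∼ a ⊕ b with a a tuple of size m ≥ 3 and b a solution of size l ≥ 3.
Reducible : ℕ → List ℤ → Set
Reducible p c =
  ∃[ a₁ ] ∃[ amid ] ∃[ aₘ ] ∃[ b₁ ] ∃[ bmid ] ∃[ bₗ ]
    (1 ℕ.≤ length amid) × (1 ℕ.≤ length bmid)
    × Solution p (b₁ ∷ (bmid ++ [ bₗ ]))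
    × Sim p c (oplus a₁ amid aₘ b₁ bmid bₗ)

Irreducible : ℕ → List ℤ → Set
Irreducible p c = Solution p c × (3 ℕ.≤ length c) × ¬ Reducible p c

-- (u, v, v) repeated k times, v playing the role of u⁻¹
trinomial : ℤ → ℤ → ℕ → List ℤ
trinomial u v k = concat (replicate k (u ∷ v ∷ v ∷ []))

IsTrinomialMinimal : ℕ → ℤ → ℤ → ℕ → Set
IsTrinomialMinimal p u v k =
  ((u ℤ.* v) ≡[ p ] (+ 1)) × (1 ℕ.≤ k) × Solution p (trinomial u v k)
  × (∀ k′ → 1 ℕ.≤ k′ → k′ ℕ.< k → ¬ Solution p (trinomial u v k′))

MinimalIrreducible : ℕ → ℤ → Set
MinimalIrreducible p u =
  ∀ v k → IsTrinomialMinimal p u v k → Irreducible p (trinomial u v k)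

-- Write v for the inverse of u and U = −u, V = −v.  Modulo p the three blocks M(u,v,v), M(v,v,u),
-- M(v,u,v) are triangular, so M of any contiguous segment of the cyclic word (u,v,v)^k has an explicit
-- (1,1) entry in terms of U^j and V^j.  If the minimal solution were ∼ a ⊕ b with b a solution, the
-- middle part of b would be such a segment with (1,1) entry ±1.  By the explicit form this means
-- either U^e ≡ ±1 for some 1 ≤ e < k, i.e. a shorter trinomial solution, or y² + εuy ≡ 1 for
-- y = u U^j and some ε ≡ ±1; then (2y + εu)² ≡ u² + 4.  For u = ±2, ±3, ±4 the number u² + 4 is
-- 8, 13, 20, and Gauss's lemma together with an Eisenstein-type lattice count (which makes (a/p)
-- depend only on p mod 4a) shows that 2, 13, 5 are non-squares under the stated congruences.  If p ∣ u² + 4 (p = 13 or 5), y must be the double root, so 2 U^j ≡ −ε; raising this to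
-- an exponent e with U^e ≡ ±1 gives 2^e ≡ ±1, false for 2³ mod 13 and 2 mod 5.
module Submission where

open import Defs
open import Data.Nat using (ℕ; _%_)
open import Data.Nat.Primality using (Prime)
open import Data.Integer using (+_; -_)
open import Data.Product using (_×_)
open import Data.Sum using (_⊎_)
open import Relation.Binary.PropositionalEquality using (_≡_; _≢_)

open import Data.Nat as ℕ using (zero; suc; _≤_; _<_; z≤n; s≤s; _∸_; _≤?_; _≟_)
import Data.Nat.Properties as ℕ
import Data.Nat.Divisibility as ℕ
open import Data.Nat.DivMod using (_/_; m≡m%n+[m/n]*n; m%n<n; m/n*n≤m; m<n⇒m/n≡0; m/n≡1+[m∸n]/n; [m+kn]%n≡m%n; m∣n⇒o%n%m≡o%m; n%n≡0)
open import Data.Nat.Primality using (euclidsLemma; ¬prime[1]; prime[2]; prime?; prime⇒irreducible)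
import Data.Nat.Tactic.RingSolver as ℕ-Solver
open import Data.Fin as Fin using (Fin; toℕ; fromℕ<)
import Data.Fin.Properties as Fin
open import Data.Fin.Permutation using (Permutation′; permutation)
open import Data.List using (List; []; _∷_; _++_; [_]; length; drop; take; reverse)
import Data.List.Properties as List
open import Data.List.Relation.Binary.Pointwise using (Pointwise; []; _∷_; Pointwise-length)
open import Data.Product using (∃-syntax; _,_; proj₁; proj₂)
open import Data.Sum using (inj₁; inj₂; [_,_]′)
import Data.Sum
open import Function using (id; _∘_)
open import Function.Definitions using (Injective)
open import Relation.Unary using (Decidable)
open import Relation.Nullary using (Dec; ¬_; yes; no; contradiction)
open import Relation.Nullary.Decidable using (map′; _⊎-dec_; _→-dec_; from-yes; from-no; True; False; toWitness; toWitnessFalse)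
open import Relation.Binary.Bundles using (Setoid)
open import Relation.Binary.Structures using (IsEquivalence)
import Relation.Binary.Reasoning.Setoid
open import Relation.Binary.PropositionalEquality using (refl; sym; trans; cong; cong₂; subst; subst₂; module ≡-Reasoning)
open import Algebra.Bundles using (CommutativeMonoid)
import Algebra.Properties.CommutativeMonoid.Sum
open import Algebra.Properties.Semiring.Sum ℕ.+-*-semiring using (sum-syntax; sum-cong-≋; ∑-comm; ∑-distrib-+; *-distribˡ-sum)

-- ℕ arithmetic is opened only inside this module, so that the ℤ operators can be used unqualified below.
module _ where

  open import Data.Nat using (_+_; _*_; NonZero)
  open import Data.Nat.DivMod using (m*n/n≡m; /-monoˡ-≤; m<n*o⇒m/o<n; +-distrib-/-∣ʳ)
  open import Data.Nat.Tactic.RingSolver using (solve-∀)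
  open import Data.Fin.Properties using (toℕ<n)
  open import Data.Bool using (true; false; if_then_else_; T)
  open import Data.Unit using (tt)

  [m+kn]/n≡m/n+k : ∀ m k n .{{_ : NonZero n}} → (m + k * n) / n ≡ m / n + k
  [m+kn]/n≡m/n+k m k n = trans (+-distrib-/-∣ʳ m (ℕ.divides k refl)) (cong (_+_ (m / n)) (m*n/n≡m k n))

  𝟙[_≤_] : ℕ → ℕ → ℕ
  𝟙[ m ≤ n ] = if m ℕ.≤ᵇ n then 1 else 0

  𝟙-yes : ∀ {m n} → m ≤ n → 𝟙[ m ≤ n ] ≡ 1
  𝟙-yes {m} {n} m≤n with m ℕ.≤ᵇ n | ℕ.≤⇒≤ᵇ m≤n
  ... | true | _ = refl

  𝟙-no : ∀ {m n} → n < m → 𝟙[ m ≤ n ] ≡ 0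
  𝟙-no {m} {n} n<m with m ℕ.≤ᵇ n in m≤ᵇn
  ... | false = refl
  ... | true  = contradiction (ℕ.≤ᵇ⇒≤ m n (subst T (sym m≤ᵇn) tt)) (ℕ.<⇒≱ n<m)

  𝟙-complement : ∀ m n → 𝟙[ m ≤ n ] + 𝟙[ suc n ≤ m ] ≡ 1
  𝟙-complement m n with m ≤? n
  ... | yes m≤n = cong₂ _+_ (𝟙-yes m≤n) (𝟙-no (s≤s m≤n))
  ... | no  m≰n = cong₂ _+_ (𝟙-no (ℕ.≰⇒> m≰n)) (𝟙-yes (ℕ.≰⇒> m≰n))

  ∑-const : ∀ n c → ∑[ i < n ] c ≡ n * c
  ∑-const zero    c = refl
  ∑-const (suc n) c = cong (_+_ c) (∑-const n c)

  count-below : ∀ {n q} → q ≤ n → ∑[ j < n ] 𝟙[ suc (toℕ j) ≤ q ] ≡ q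
  count-below {zero}          z≤n       = refl
  count-below {suc n} {zero}  _         = count-below {n} z≤n
  count-below {suc n} {suc q} (s≤s q≤n) = cong suc (count-below q≤n)

  floor-as-count : ∀ n d X .{{_ : NonZero d}} → X < suc n * d →
    ∑[ j < n ] 𝟙[ suc (toℕ j) * d ≤ X ] ≡ X / d
  floor-as-count n d X X<[n+1]d =
    trans (sum-cong-≋ {n} same-indicator) (count-below {n} (ℕ.s≤s⁻¹ (m<n*o⇒m/o<n X<[n+1]d)))
    where
    same-indicator : ∀ j → 𝟙[ suc (toℕ j) * d ≤ X ] ≡ 𝟙[ suc (toℕ j) ≤ X / d ]
    same-indicator j with suc (toℕ j) ≤? X / d
    ... | yes k≤X/d = trans (𝟙-yes (ℕ.≤-trans (ℕ.*-monoˡ-≤ d k≤X/d) (m/n*n≤m X d))) (sym (𝟙-yes k≤X/d))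
    ... | no  k≰X/d = trans (𝟙-no (ℕ.≰⇒> λ kd≤X → k≰X/d (subst (_≤ X / d) (m*n/n≡m (suc (toℕ j)) d) (/-monoˡ-≤ d kd≤X))))
                            (sym (𝟙-no (ℕ.≰⇒> k≰X/d)))

  gaussExponent : ℕ → ℕ → ℕ
  gaussExponent h x = ∑[ i < h ] (suc (toℕ i) * (2 * x) / suc (2 * h))

  lowerCount : ℕ → ℕ → ℕ
  lowerCount b r = ∑[ j < b ] ((suc (toℕ j) * r ∸ 1) / (2 * suc b))

  module _ (h b : ℕ) where
    private
      p a : ℕ
      p = suc (2 * h)
      a = suc b
      X : Fin h → ℕ
      X i = suc (toℕ i) * (2 * a)
      Y : Fin b → ℕ
      Y j = suc (toℕ j) * p ∸ 1
      I : Fin h → Fin b → ℕ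
      I i j = 𝟙[ suc (toℕ j) * p ≤ X i ]

      X<ap : ∀ i → X i < a * p
      X<ap i = begin-strict
        suc (toℕ i) * (2 * a)  ≤⟨ ℕ.*-monoˡ-≤ (2 * a) (toℕ<n i) ⟩
        h * (2 * a)            ≡⟨ rearrange h a ⟩
        a * (2 * h)            <⟨ ℕ.*-monoʳ-< a (ℕ.n<1+n (2 * h)) ⟩
        a * p                  ∎
        where open ℕ.≤-Reasoning
              rearrange : ∀ h a → h * (2 * a) ≡ a * (2 * h)
              rearrange = solve-∀

      Y<[h+1]2a : ∀ j → Y j < suc h * (2 * a)
      Y<[h+1]2a j = begin-strict
        Y j                    <⟨ ℕ.n<1+n (Y j) ⟩
        suc (toℕ j) * p        ≤⟨ ℕ.*-monoˡ-≤ p (ℕ.m≤n⇒m≤1+n (toℕ<n j)) ⟩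
        a * p                  ≤⟨ ℕ.*-monoʳ-≤ a (ℕ.n≤1+n p) ⟩
        a * suc p              ≡⟨ rearrange h a ⟩
        suc h * (2 * a)        ∎
        where open ℕ.≤-Reasoning
              rearrange : ∀ h a → a * suc (suc (2 * h)) ≡ suc h * (2 * a)
              rearrange = solve-∀

    -- The two sums count the pairs (i, j) ∈ [1, h] × [1, b] with j p ≤ 2 a i and with j p > 2 a i.
    floor-reciprocity : gaussExponent h a + lowerCount b p ≡ b * h
    floor-reciprocity = begin
      gaussExponent h a + lowerCount b p
        ≡⟨ cong₂ _+_ (sum-cong-≋ {h} λ i → sym (floor-as-count b p (X i) (X<ap i)))
                     (sum-cong-≋ {b} λ j → sym (floor-as-count h (2 * a) (Y j) (Y<[h+1]2a j))) ⟩
      ∑[ i < h ] ∑[ j < b ] I i j + ∑[ j < b ] ∑[ i < h ] 𝟙[ X i ≤ Y j ]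
        ≡⟨ cong (_+ ∑[ j < b ] ∑[ i < h ] 𝟙[ X i ≤ Y j ]) (∑-comm {h} {b} I) ⟩
      ∑[ j < b ] ∑[ i < h ] I i j + ∑[ j < b ] ∑[ i < h ] 𝟙[ X i ≤ Y j ]
        ≡⟨ ∑-distrib-+ {b} (λ j → ∑[ i < h ] I i j) (λ j → ∑[ i < h ] 𝟙[ X i ≤ Y j ]) ⟨
      ∑[ j < b ] (∑[ i < h ] I i j + ∑[ i < h ] 𝟙[ X i ≤ Y j ])
        ≡⟨ sum-cong-≋ {b} (λ j → ∑-distrib-+ {h} (λ i → I i j) (λ i → 𝟙[ X i ≤ Y j ])) ⟨
      ∑[ j < b ] ∑[ i < h ] (I i j + 𝟙[ X i ≤ Y j ])
        ≡⟨ sum-cong-≋ {b} (λ j → sum-cong-≋ {h} λ i → 𝟙-complement (suc (toℕ j) * p) (X i)) ⟩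
      ∑[ j < b ] ∑[ i < h ] 1
        ≡⟨ sum-cong-≋ {b} (λ _ → trans (∑-const h 1) (ℕ.*-identityʳ h)) ⟩
      ∑[ j < b ] h
        ≡⟨ ∑-const b h ⟩
      b * h ∎
      where open ≡-Reasoning

  lowerCount-shift : ∀ b s m → let r = suc (2 * s) in
    lowerCount b (r + m * (4 * suc b)) ≡ lowerCount b r + 2 * m * ∑[ j < b ] suc (toℕ j)
  lowerCount-shift b s m = begin
    lowerCount b (r + m * (4 * a))                                       ≡⟨ sum-cong-≋ {b} shift ⟩
    ∑[ j < b ] ((suc (toℕ j) * r ∸ 1) / (2 * a) + 2 * m * suc (toℕ j))   ≡⟨ ∑-distrib-+ {b} _ _ ⟩
    lowerCount b r + ∑[ j < b ] (2 * m * suc (toℕ j))                    ≡⟨ cong (_+_ (lowerCount b r)) (*-distribˡ-sum {b} (2 * m) _) ⟨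
    lowerCount b r + 2 * m * ∑[ j < b ] suc (toℕ j)                      ∎
    where
    open ≡-Reasoning
    a = suc b
    r = suc (2 * s)
    expand : ∀ s m b j → 2 * s + m * (4 * suc b) + j * (suc (2 * s) + m * (4 * suc b))
                       ≡ (2 * s + j * suc (2 * s)) + 2 * m * suc j * (2 * suc b)
    expand = solve-∀
    shift : ∀ j → (suc (toℕ j) * (r + m * (4 * a)) ∸ 1) / (2 * a) ≡ (suc (toℕ j) * r ∸ 1) / (2 * a) + 2 * m * suc (toℕ j)
    shift j = trans (cong (_/ (2 * a)) (expand s m b (toℕ j)))
                    ([m+kn]/n≡m/n+k (suc (toℕ j) * r ∸ 1) (2 * m * suc (toℕ j)) (2 * a))

  gaussExponent-parity : ∀ h b s m → suc (2 * h) ≡ suc (2 * s) + m * (4 * suc b) →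
    gaussExponent h (suc b) % 2 ≡ (b * s + lowerCount b (suc (2 * s))) % 2
  gaussExponent-parity h b s m p≡ = begin
    G % 2                            ≡⟨ [m+kn]%n≡m%n G (L + m * Σj) 2 ⟨
    (G + (L + m * Σj) * 2) % 2       ≡⟨ cong (_% 2) (regroupˡ G L m Σj) ⟩
    (G + (L + 2 * m * Σj) + L) % 2   ≡⟨ cong (λ z → (z + L) % 2) reciprocity ⟩
    (b * (s + m * (2 * a)) + L) % 2  ≡⟨ cong (_% 2) (regroupʳ b s m a L) ⟩
    (b * s + L + b * m * a * 2) % 2  ≡⟨ [m+kn]%n≡m%n (b * s + L) (b * m * a) 2 ⟩
    (b * s + L) % 2                  ∎
    where
    open ≡-Reasoning
    a = suc b
    G = gaussExponent h a
    L = lowerCount b (suc (2 * s))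
    Σj = ∑[ j < b ] suc (toℕ j)
    regroupˡ : ∀ G L m Σj → G + (L + m * Σj) * 2 ≡ G + (L + 2 * m * Σj) + L
    regroupˡ = solve-∀
    regroupʳ : ∀ b s m a L → b * (s + m * (2 * a)) + L ≡ b * s + L + b * m * a * 2
    regroupʳ = solve-∀
    h≡ : h ≡ s + m * (2 * a)
    h≡ = ℕ.*-cancelˡ-≡ h (s + m * (2 * a)) 2 (trans (ℕ.suc-injective p≡) (halve s m a))
      where halve : ∀ s m a → 2 * s + m * (4 * a) ≡ 2 * (s + m * (2 * a))
            halve = solve-∀
    reciprocity : G + (L + 2 * m * Σj) ≡ b * (s + m * (2 * a))
    reciprocity = begin
      G + (L + 2 * m * Σj)            ≡⟨ cong (_+_ G) (trans (cong (lowerCount b) p≡) (lowerCount-shift b s m)) ⟨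
      G + lowerCount b (suc (2 * h))  ≡⟨ floor-reciprocity h b ⟩
      b * h                           ≡⟨ cong (b *_) h≡ ⟩
      b * (s + m * (2 * a))           ∎

open import Data.Integer as ℤ using (ℤ; _-_; _+_; _*_; _^_; ∣_∣)
import Data.Integer.Properties as ℤ
import Data.Integer.DivMod as ℤ
open import Data.Integer.DivMod using (a≡a%ℕn+[a/ℕn]*n)
open import Data.Integer.Divisibility.Signed as Signed using (divides; ∣⇒∣ᵤ; ∣ᵤ⇒∣)
open import Data.Integer.Tactic.RingSolver using (solve-∀)

module Modular (p : ℕ) where

  -- A record around _≡[ p ]_, so that unification can recover both sides.
  infix 4 _≈_
  record _≈_ (x y : ℤ) : Set where
    constructor ≡[]⇒≈
    field ≈⇒≡[] : x ≡[ p ] y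
  open _≈_ public

  ≈-multiple : ∀ {x y} k → x - y ≡ k * + p → x ≈ y
  ≈-multiple k eq = ≡[]⇒≈ (∣⇒∣ᵤ (divides k eq))

  private
    signed : ∀ {x y} → x ≈ y → + p Signed.∣ (x - y)
    signed x≈y = ∣ᵤ⇒∣ (≈⇒≡[] x≈y)

    ≈-via : ∀ {d x y} → d ≡ x - y → + p Signed.∣ d → x ≈ y
    ≈-via d≡ p∣d = ≡[]⇒≈ (∣⇒∣ᵤ (subst (+ p Signed.∣_) d≡ p∣d))

  ≈-refl : ∀ {x} → x ≈ x
  ≈-refl {x} = ≈-multiple (+ 0) (ℤ.+-inverseʳ x)

  ≡⇒≈ : ∀ {x y} → x ≡ y → x ≈ y
  ≡⇒≈ refl = ≈-refl

  ≈-sym : ∀ {x y} → x ≈ y → y ≈ x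
  ≈-sym {x} {y} x≈y = ≈-via (negate x y) (Signed.∣m⇒∣-m (signed x≈y))
    where negate : ∀ x y → - (x - y) ≡ y - x
          negate = solve-∀

  ≈-trans : ∀ {x y z} → x ≈ y → y ≈ z → x ≈ z
  ≈-trans {x} {y} {z} x≈y y≈z = ≈-via (telescope x y z) (Signed.∣m∣n⇒∣m+n (signed x≈y) (signed y≈z))
    where telescope : ∀ x y z → (x - y) + (y - z) ≡ x - z
          telescope = solve-∀

  ≈-isEquivalence : IsEquivalence _≈_
  ≈-isEquivalence = record { refl = ≈-refl ; sym = ≈-sym ; trans = ≈-trans }

  setoid : Setoid _ _
  setoid = record { isEquivalence = ≈-isEquivalence }

  module ≈-Reasoning = Relation.Binary.Reasoning.Setoid setoid

  +-cong : ∀ {x y x′ y′} → x ≈ x′ → y ≈ y′ → x + y ≈ x′ + y′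
  +-cong {x} {y} {x′} {y′} x≈x′ y≈y′ = ≈-via (regroup x y x′ y′) (Signed.∣m∣n⇒∣m+n (signed x≈x′) (signed y≈y′))
    where regroup : ∀ x y x′ y′ → (x - x′) + (y - y′) ≡ (x + y) - (x′ + y′)
          regroup = solve-∀

  *-cong : ∀ {x y x′ y′} → x ≈ x′ → y ≈ y′ → x * y ≈ x′ * y′
  *-cong {x} {y} {x′} {y′} x≈x′ y≈y′ =
    ≈-via (regroup x y x′ y′)
          (Signed.∣m∣n⇒∣m+n (Signed.∣n⇒∣m*n x (signed y≈y′)) (Signed.∣m⇒∣m*n y′ (signed x≈x′)))
    where regroup : ∀ x y x′ y′ → x * (y - y′) + (x - x′) * y′ ≡ x * y - x′ * y′
          regroup = solve-∀

  -‿cong : ∀ {x y} → x ≈ y → - x ≈ - y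
  -‿cong {x} {y} x≈y = ≈-via (regroup x y) (Signed.∣m⇒∣-m (signed x≈y))
    where regroup : ∀ x y → - (x - y) ≡ - x - - y
          regroup = solve-∀

  -cong : ∀ {x y x′ y′} → x ≈ x′ → y ≈ y′ → x - y ≈ x′ - y′
  -cong x≈x′ y≈y′ = +-cong x≈x′ (-‿cong y≈y′)

  *-congˡ : ∀ {x y} z → x ≈ y → z * x ≈ z * y
  *-congˡ z = *-cong (≈-refl {z})

  *-congʳ : ∀ {x y} z → x ≈ y → x * z ≈ y * z
  *-congʳ z x≈y = *-cong x≈y (≈-refl {z})

  ^-congˡ : ∀ {x y} n → x ≈ y → x ^ n ≈ y ^ n
  ^-congˡ zero    x≈y = ≈-refl
  ^-congˡ (suc n) x≈y = *-cong x≈y (^-congˡ n x≈y)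

  x-y≈0⇒x≈y : ∀ {x y} → x - y ≈ + 0 → x ≈ y
  x-y≈0⇒x≈y {x} {y} x-y≈0 = ≡[]⇒≈ (subst (λ z → p ℕ.∣ ∣ z ∣) (ℤ.+-identityʳ (x - y)) (≈⇒≡[] x-y≈0))

  ≈0⇒∣ : ∀ {x} → x ≈ + 0 → p ℕ.∣ ∣ x ∣
  ≈0⇒∣ {x} x≈0 = subst (λ z → p ℕ.∣ ∣ z ∣) (ℤ.+-identityʳ x) (≈⇒≡[] x≈0)

  ∣⇒≈0 : ∀ {x} → p ℕ.∣ ∣ x ∣ → x ≈ + 0
  ∣⇒≈0 {x} p∣x = ≡[]⇒≈ (subst (λ z → p ℕ.∣ ∣ z ∣) (sym (ℤ.+-identityʳ x)) p∣x)

  p≈0 : + p ≈ + 0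
  p≈0 = ≈-multiple (+ 1) (trans (ℤ.+-identityʳ (+ p)) (sym (ℤ.*-identityˡ (+ p))))

  ≈-remainder : ∀ {n r} t → n ≡ r ℕ.+ t ℕ.* p → + n ≈ + r
  ≈-remainder {r = r} t refl = ≈-multiple (+ t) (begin
    + (r ℕ.+ t ℕ.* p) - + r   ≡⟨ cong (_- + r) (trans (ℤ.pos-+ r (t ℕ.* p)) (cong (_+_ (+ r)) (ℤ.pos-* t p))) ⟩
    + r + + t * + p - + r     ≡⟨ cancel (+ r) (+ t * + p) ⟩
    + t * + p                 ∎)
    where open ≡-Reasoning
          cancel : ∀ r x → r + x - r ≡ x
          cancel = solve-∀

  ≈-dec : ∀ x y → Dec (x ≈ y)
  ≈-dec x y = map′ ≡[]⇒≈ ≈⇒≡[] (p ℕ.∣? ∣ x - y ∣)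

  IsSquare : ℤ → Set
  IsSquare c = ∃[ w ] w * w ≈ c

  *-commutativeMonoid : CommutativeMonoid _ _
  *-commutativeMonoid = record
    { Carrier = ℤ ; _≈_ = _≈_ ; _∙_ = _*_ ; ε = + 1
    ; isCommutativeMonoid = record
      { isMonoid = record
        { isSemigroup = record
          { isMagma = record { isEquivalence = ≈-isEquivalence ; ∙-cong = *-cong }
          ; assoc = λ x y z → ≡⇒≈ (ℤ.*-assoc x y z) }
        ; identity = (λ x → ≡⇒≈ (ℤ.*-identityˡ x)) , (λ x → ≡⇒≈ (ℤ.*-identityʳ x)) }
      ; comm = λ x y → ≡⇒≈ (ℤ.*-comm x y) } }

  infix 4 _≈±1
  _≈±1 : ℤ → Set
  x ≈±1 = x ≈ + 1 ⊎ x ≈ - + 1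

  ≈±1-dec : ∀ x → Dec (x ≈±1)
  ≈±1-dec x = ≈-dec x (+ 1) ⊎-dec ≈-dec x (- + 1)

  ≈±1-respˡ : ∀ {x y} → x ≈ y → y ≈±1 → x ≈±1
  ≈±1-respˡ x≈y (inj₁ y≈1)  = inj₁ (≈-trans x≈y y≈1)
  ≈±1-respˡ x≈y (inj₂ y≈-1) = inj₂ (≈-trans x≈y y≈-1)

  -‿≈±1 : ∀ {x} → x ≈±1 → - x ≈±1
  -‿≈±1 (inj₁ x≈1)  = inj₂ (-‿cong x≈1)
  -‿≈±1 (inj₂ x≈-1) = inj₁ (-‿cong x≈-1)

  -‿≈±1⁻ : ∀ {x} → - x ≈±1 → x ≈±1
  -‿≈±1⁻ {x} -x≈±1 = subst _≈±1 (ℤ.neg-involutive x) (-‿≈±1 -x≈±1)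

  ≈±1-* : ∀ {x y} → x ≈±1 → y ≈±1 → x * y ≈±1
  ≈±1-* (inj₁ x≈1)  (inj₁ y≈1)  = inj₁ (*-cong x≈1 y≈1)
  ≈±1-* (inj₁ x≈1)  (inj₂ y≈-1) = inj₂ (*-cong x≈1 y≈-1)
  ≈±1-* (inj₂ x≈-1) (inj₁ y≈1)  = inj₂ (*-cong x≈-1 y≈1)
  ≈±1-* (inj₂ x≈-1) (inj₂ y≈-1) = inj₁ (*-cong x≈-1 y≈-1)

  ≈±1-^ : ∀ {x} n → x ≈±1 → x ^ n ≈±1
  ≈±1-^ zero    _    = inj₁ ≈-refl
  ≈±1-^ (suc n) x≈±1 = ≈±1-* x≈±1 (≈±1-^ n x≈±1)

  ≈±1-square : ∀ {x} → x ≈±1 → x * x ≈ + 1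
  ≈±1-square (inj₁ x≈1)  = *-cong x≈1 x≈1
  ≈±1-square (inj₂ x≈-1) = *-cong x≈-1 x≈-1

  ≈±1-cancelʳ : ∀ {x y} → x * y ≈±1 → y ≈±1 → x ≈±1
  ≈±1-cancelʳ {x} {y} xy≈±1 y≈±1 = ≈±1-respˡ x≈xyy (≈±1-* xy≈±1 y≈±1)
    where
    open ≈-Reasoning
    x≈xyy : x ≈ x * y * y
    x≈xyy = begin
      x            ≡⟨ ℤ.*-identityʳ x ⟨
      x * + 1      ≈⟨ *-congˡ x (≈±1-square y≈±1) ⟨
      x * (y * y)  ≡⟨ ℤ.*-assoc x y y ⟨
      x * y * y    ∎

  infix 4 _≈ᴹ_
  _≈ᴹ_ : Mat → Mat → Set
  A ≈ᴹ B = m11 A ≈ m11 B × m12 A ≈ m12 B × m21 A ≈ m21 B × m22 A ≈ m22 B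
    where open Mat

  ≈ᴹ-refl : ∀ {A} → A ≈ᴹ A
  ≈ᴹ-refl = ≈-refl , ≈-refl , ≈-refl , ≈-refl

  ≡⇒≈ᴹ : ∀ {A B} → A ≡ B → A ≈ᴹ B
  ≡⇒≈ᴹ refl = ≈ᴹ-refl

  ≈ᴹ-trans : ∀ {A B C} → A ≈ᴹ B → B ≈ᴹ C → A ≈ᴹ C
  ≈ᴹ-trans (a , b , c , d) (a′ , b′ , c′ , d′) = ≈-trans a a′ , ≈-trans b b′ , ≈-trans c c′ , ≈-trans d d′

  ·-cong : ∀ {A B A′ B′} → A ≈ᴹ A′ → B ≈ᴹ B′ → A · B ≈ᴹ A′ · B′
  ·-cong (a , b , c , d) (e , f , g , h) =
    +-cong (*-cong a e) (*-cong b g) , +-cong (*-cong a f) (*-cong b h) ,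
    +-cong (*-cong c e) (*-cong d g) , +-cong (*-cong c f) (*-cong d h)

  M-cong : ∀ {xs ys} → xs ≋[ p ] ys → M xs ≈ᴹ M ys
  M-cong []             = ≈ᴹ-refl
  M-cong (x≡[]y ∷ rest) = ·-cong (M-cong rest) (≡[]⇒≈ x≡[]y , ≈-refl , ≈-refl , ≈-refl)

  ≈ᴹ⇒≈[] : ∀ {A B} → A ≈ᴹ B → A ≈[ p ] B
  ≈ᴹ⇒≈[] (a , b , c , d) = ≈⇒≡[] a , ≈⇒≡[] b , ≈⇒≡[] c , ≈⇒≡[] d

  module _ (p-prime : Prime p) where

    0≉±1 : ¬ + 0 ≈±1
    0≉±1 (inj₁ 0≈1)  = ¬prime[1] (subst Prime (ℕ.∣1⇒≡1 (≈⇒≡[] 0≈1)) p-prime)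
    0≉±1 (inj₂ 0≈-1) = ¬prime[1] (subst Prime (ℕ.∣1⇒≡1 (≈⇒≡[] 0≈-1)) p-prime)

    ≈0-product : ∀ {x y} → x * y ≈ + 0 → x ≈ + 0 ⊎ y ≈ + 0
    ≈0-product {x} {y} xy≈0 with euclidsLemma ∣ x ∣ ∣ y ∣ p-prime (subst (p ℕ.∣_) (ℤ.abs-* x y) (≈0⇒∣ xy≈0))
    ... | inj₁ p∣x = inj₁ (∣⇒≈0 p∣x)
    ... | inj₂ p∣y = inj₂ (∣⇒≈0 p∣y)

    ≈0-square : ∀ {x} → x * x ≈ + 0 → x ≈ + 0
    ≈0-square xx≈0 = [ id , id ]′ (≈0-product xx≈0)

    *-cancelˡ : ∀ {x y z} → ¬ z ≈ + 0 → z * x ≈ z * y → x ≈ y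
    *-cancelˡ {x} {y} {z} z≉0 zx≈zy =
      x-y≈0⇒x≈y ([ (λ z≈0 → contradiction z≈0 z≉0) , id ]′ (≈0-product (begin
        z * (x - y)      ≡⟨ ℤ.*-distribˡ-+ z x (- y) ⟩
        z * x + z * - y  ≡⟨ cong (_+_ (z * x)) (ℤ.neg-distribʳ-* z y) ⟨
        z * x - z * y    ≈⟨ -cong zx≈zy (≈-refl {z * y}) ⟩
        z * y - z * y    ≡⟨ ℤ.+-inverseʳ (z * y) ⟩
        + 0              ∎)))
      where open ≈-Reasoning

    *-cancelʳ : ∀ {x y z} → ¬ z ≈ + 0 → x * z ≈ y * z → x ≈ y
    *-cancelʳ {x} {y} {z} z≉0 xz≈yz =
      *-cancelˡ z≉0 (≈-trans (≡⇒≈ (ℤ.*-comm z x)) (≈-trans xz≈yz (≡⇒≈ (ℤ.*-comm y z))))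

mat-≡ : ∀ {a b c d a′ b′ c′ d′} → a ≡ a′ → b ≡ b′ → c ≡ c′ → d ≡ d′ → mat a b c d ≡ mat a′ b′ c′ d′
mat-≡ refl refl refl refl = refl

·-assoc : ∀ A B C → (A · B) · C ≡ A · (B · C)
·-assoc (mat a b c d) (mat e f g h) (mat i j k l) =
  mat-≡ (entry a b e f g h i k) (entry a b e f g h j l) (entry c d e f g h i k) (entry c d e f g h j l)
  where
  entry : ∀ x y e f g h z w → (x * e + y * g) * z + (x * f + y * h) * w ≡ x * (e * z + f * w) + y * (g * z + h * w)
  entry = solve-∀

·-identityˡ : ∀ A → Id · A ≡ A
·-identityˡ (mat a b c d) = mat-≡ (first a c) (first b d) (second a c) (second b d)
  where
  first : ∀ x y → + 1 * x + + 0 * y ≡ x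
  first = solve-∀
  second : ∀ x y → + 0 * x + + 1 * y ≡ y
  second = solve-∀

·-identityʳ : ∀ A → A · Id ≡ A
·-identityʳ (mat a b c d) = mat-≡ (first a b) (second a b) (first c d) (second c d)
  where
  first : ∀ x y → x * + 1 + y * + 0 ≡ x
  first = solve-∀
  second : ∀ x y → x * + 0 + y * + 1 ≡ y
  second = solve-∀

M-++ : ∀ xs ys → M (xs ++ ys) ≡ M ys · M xs
M-++ []       ys = sym (·-identityʳ (M ys))
M-++ (x ∷ xs) ys = trans (cong (_· step x) (M-++ xs ys)) (·-assoc (M ys) (M xs) (step x))

M-[x] : ∀ x → M [ x ] ≡ step x
M-[x] x = ·-identityˡ (step x)

M-[x,y] : ∀ x y → M (x ∷ y ∷ []) ≡ mat (y * x - + 1) (- y) x (- + 1)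
M-[x,y] x y = trans (cong (_· step x) (M-[x] y))
  (mat-≡ (e₁₁ x y) (e₁₂ y) (e₂₁ x) refl)
  where
  e₁₁ : ∀ x y → y * x + - + 1 * + 1 ≡ y * x - + 1
  e₁₁ = solve-∀
  e₁₂ : ∀ y → y * - + 1 + - + 1 * + 0 ≡ - y
  e₁₂ = solve-∀
  e₂₁ : ∀ x → + 1 * x + + 0 * + 1 ≡ x
  e₂₁ = solve-∀

M-[x,y,z] : ∀ x y z → M (x ∷ y ∷ z ∷ []) ≡ mat ((z * y - + 1) * x - z) (+ 1 - z * y) (y * x - + 1) (- y)
M-[x,y,z] x y z = trans (cong (_· step x) (M-[x,y] y z))
  (mat-≡ (e₁₁ x y z) (e₁₂ y z) (e₂₁ x y) (e₂₂ y))
  where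
  e₁₁ : ∀ x y z → (z * y - + 1) * x + - z * + 1 ≡ (z * y - + 1) * x - z
  e₁₁ = solve-∀
  e₁₂ : ∀ y z → (z * y - + 1) * - + 1 + - z * + 0 ≡ + 1 - z * y
  e₁₂ = solve-∀
  e₂₁ : ∀ x y → y * x + - + 1 * + 1 ≡ y * x - + 1
  e₂₁ = solve-∀
  e₂₂ : ∀ y → y * - + 1 + - + 1 * + 0 ≡ - y
  e₂₂ = solve-∀

module PeriodicWord (u v : ℤ) where

  letter : ℕ → ℤ
  letter 0 = u
  letter 1 = v
  letter 2 = v
  letter (suc (suc (suc i))) = letter i

  word : ℕ → ℕ → List ℤ
  word s zero    = []
  word s (suc L) = letter s ∷ word (suc s) L

  word-3+ : ∀ s L → word (3 ℕ.+ s) L ≡ word s L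
  word-3+ s zero    = refl
  word-3+ s (suc L) = cong (letter s ∷_) (word-3+ (suc s) L)

  word-*3+ : ∀ j s L → word (j ℕ.* 3 ℕ.+ s) L ≡ word s L
  word-*3+ zero    s L = refl
  word-*3+ (suc j) s L = trans (word-3+ (j ℕ.* 3 ℕ.+ s) L) (word-*3+ j s L)

  word-++ : ∀ s L L′ → word s (L ℕ.+ L′) ≡ word s L ++ word (L ℕ.+ s) L′
  word-++ s zero    L′ = refl
  word-++ s (suc L) L′ = cong (letter s ∷_) (trans (word-++ (suc s) L L′) (cong (λ t → word (suc s) L ++ word t L′) (ℕ.+-suc L s)))

  length-word : ∀ s L → length (word s L) ≡ L
  length-word s zero    = refl
  length-word s (suc L) = cong suc (length-word (suc s) L)

  drop-word : ∀ j s L → drop j (word s L) ≡ word (j ℕ.+ s) (L ∸ j)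
  drop-word zero    s L       = refl
  drop-word (suc j) s zero    = refl
  drop-word (suc j) s (suc L) = trans (drop-word j (suc s) L) (cong (λ t → word t (L ∸ j)) (ℕ.+-suc j s))

  take-word : ∀ j s L → take j (word s L) ≡ word s (j ℕ.⊓ L)
  take-word zero    s L       = refl
  take-word (suc j) s zero    = refl
  take-word (suc j) s (suc L) = cong (letter s ∷_) (take-word j (suc s) L)

  rotate-word : ∀ j s K → ∃[ s′ ] rotate j (word s (K ℕ.* 3)) ≡ word s′ (K ℕ.* 3)
  rotate-word j s K with j ≤? K ℕ.* 3
  ... | no j≰n = s , (begin
    drop j (word s n) ++ take j (word s n)   ≡⟨ cong₂ _++_ (trans (drop-word j s n) (cong (word (j ℕ.+ s)) (ℕ.m≤n⇒m∸n≡0 n≤j)))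
                                                          (trans (take-word j s n) (cong (word s) (ℕ.m≥n⇒m⊓n≡n n≤j))) ⟩
    word s n ∎)
    where open ≡-Reasoning
          n = K ℕ.* 3
          n≤j = ℕ.<⇒≤ (ℕ.≰⇒> j≰n)
  ... | yes j≤n = j ℕ.+ s , (begin
    drop j (word s n) ++ take j (word s n)          ≡⟨ cong₂ _++_ (drop-word j s n) (trans (take-word j s n) (cong (word s) (ℕ.m≤n⇒m⊓n≡m j≤n))) ⟩
    word (j ℕ.+ s) (n ∸ j) ++ word s j              ≡⟨ cong (word (j ℕ.+ s) (n ∸ j) ++_) (sym (word-*3+ K s j)) ⟩
    word (j ℕ.+ s) (n ∸ j) ++ word (n ℕ.+ s) j      ≡⟨ cong (λ t → word (j ℕ.+ s) (n ∸ j) ++ word t j) (sym wraps) ⟩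
    word (j ℕ.+ s) (n ∸ j) ++ word ((n ∸ j) ℕ.+ (j ℕ.+ s)) j ≡⟨ sym (word-++ (j ℕ.+ s) (n ∸ j) j) ⟩
    word (j ℕ.+ s) ((n ∸ j) ℕ.+ j)                  ≡⟨ cong (word (j ℕ.+ s)) (ℕ.m∸n+n≡m j≤n) ⟩
    word (j ℕ.+ s) n ∎)
    where open ≡-Reasoning
          n = K ℕ.* 3
          wraps : (n ∸ j) ℕ.+ (j ℕ.+ s) ≡ n ℕ.+ s
          wraps = trans (sym (ℕ.+-assoc (n ∸ j) j s)) (cong (ℕ._+ s) (ℕ.m∸n+n≡m j≤n))

  trinomial≡word : ∀ K → trinomial u v K ≡ word 0 (K ℕ.* 3)
  trinomial≡word zero    = refl
  trinomial≡word (suc K) = cong (λ w → u ∷ v ∷ v ∷ w) (trans (trinomial≡word K) (sym (word-3+ 0 (K ℕ.* 3))))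

  reverse-trinomial≡word : ∀ K → reverse (trinomial u v K) ≡ word 1 (K ℕ.* 3)
  reverse-trinomial≡word zero    = refl
  reverse-trinomial≡word (suc K) = begin
    reverse ((u ∷ v ∷ v ∷ []) ++ trinomial u v K)  ≡⟨ List.reverse-++ (u ∷ v ∷ v ∷ []) (trinomial u v K) ⟩
    reverse (trinomial u v K) ++ word 1 3          ≡⟨ cong₂ _++_ (reverse-trinomial≡word K) (sym (word-*3+ K 1 3)) ⟩
    word 1 (K ℕ.* 3) ++ word (K ℕ.* 3 ℕ.+ 1) 3     ≡⟨ sym (word-++ 1 (K ℕ.* 3) 3) ⟩
    word 1 (K ℕ.* 3 ℕ.+ 3)                         ≡⟨ cong (word 1) (ℕ.+-comm (K ℕ.* 3) 3) ⟩
    word 1 (suc K ℕ.* 3) ∎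
    where open ≡-Reasoning

  word-phase : ∀ s L → ∃[ s₀ ] s₀ < 3 × word s L ≡ word s₀ L
  word-phase 0 L = 0 , s≤s z≤n , refl
  word-phase 1 L = 1 , s≤s (s≤s z≤n) , refl
  word-phase 2 L = 2 , s≤s (s≤s (s≤s z≤n)) , refl
  word-phase (suc (suc (suc s))) L with word-phase s L
  ... | s₀ , s₀<3 , eq = s₀ , s₀<3 , trans (word-3+ s L) eq

  M-word-split : ∀ s j r → M (word s (j ℕ.* 3 ℕ.+ r)) ≡ M (word s r) · M (word s (j ℕ.* 3))
  M-word-split s j r = begin
    M (word s (j ℕ.* 3 ℕ.+ r))                        ≡⟨ cong M (word-++ s (j ℕ.* 3) r) ⟩
    M (word s (j ℕ.* 3) ++ word (j ℕ.* 3 ℕ.+ s) r)    ≡⟨ M-++ (word s (j ℕ.* 3)) _ ⟩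
    M (word (j ℕ.* 3 ℕ.+ s) r) · M (word s (j ℕ.* 3)) ≡⟨ cong (λ w → M w · M (word s (j ℕ.* 3))) (word-*3+ j s r) ⟩
    M (word s r) · M (word s (j ℕ.* 3)) ∎
    where open ≡-Reasoning

Pointwise-drop : ∀ {A B : Set} {R : A → B → Set} {xs ys} n → Pointwise R xs ys → Pointwise R (drop n xs) (drop n ys)
Pointwise-drop zero    xs∼ys       = xs∼ys
Pointwise-drop (suc n) []          = []
Pointwise-drop (suc n) (_ ∷ xs∼ys) = Pointwise-drop n xs∼ys

drop-++-∷ : ∀ {A : Set} (xs : List A) {y ys} → drop (suc (length xs)) (xs ++ y ∷ ys) ≡ ys
drop-++-∷ []       = refl
drop-++-∷ (x ∷ xs) = drop-++-∷ xs

module _ {p : ℕ} where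
  open Modular p

  solution⇒m22-≈±1 : ∀ {xs} → Solution p xs → Mat.m22 (M xs) ≈±1
  solution⇒m22-≈±1 (inj₁ (_ , _ , _ , m22≡1))  = inj₁ (≡[]⇒≈ m22≡1)
  solution⇒m22-≈±1 (inj₂ (_ , _ , _ , m22≡-1)) = inj₂ (≡[]⇒≈ m22≡-1)

  solution⇒inner-m11-≈±1 : ∀ b₁ bmid bₗ → Solution p (b₁ ∷ (bmid ++ [ bₗ ])) → Mat.m11 (M bmid) ≈±1
  solution⇒inner-m11-≈±1 b₁ bmid bₗ sol =
    -‿≈±1⁻ {Mat.m11 (M bmid)} (subst _≈±1 m22≡-m11 (solution⇒m22-≈±1 {b₁ ∷ (bmid ++ [ bₗ ])} sol))
    where
    open Mat (M bmid)
    outer : ∀ a b c d → (+ 1 * a + + 0 * c) * - + 1 + (+ 1 * b + + 0 * d) * + 0 ≡ - a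
    outer = solve-∀
    m22≡-m11 : Mat.m22 (M (b₁ ∷ (bmid ++ [ bₗ ]))) ≡ - m11
    m22≡-m11 = begin
      Mat.m22 (M (bmid ++ [ bₗ ]) · step b₁)     ≡⟨ cong (λ N → Mat.m22 (N · step b₁)) (trans (M-++ bmid [ bₗ ]) (cong (_· M bmid) (M-[x] bₗ))) ⟩
      Mat.m22 ((step bₗ · M bmid) · step b₁)     ≡⟨ outer m11 m12 m21 m22 ⟩
      - m11 ∎
      where open ≡-Reasoning

module _ (p : ℕ) (u v : ℤ) where
  open Modular p
  open PeriodicWord u v

  private
    rotation≋word : ∀ K {d} → Sim p (trinomial u v K) d → ∃[ s ] word s (K ℕ.* 3) ≋[ p ] d
    rotation≋word K (k , inj₁ rot≋d) with rotate-word k 0 K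
    ... | s , rot≡word = s , subst (_≋[ p ] _) (trans (cong (rotate k) (trinomial≡word K)) rot≡word) rot≋d
    rotation≋word K (k , inj₂ rot≋d) with rotate-word k 1 K
    ... | s , rot≡word = s , subst (_≋[ p ] _) (trans (cong (rotate k) (reverse-trinomial≡word K)) rot≡word) rot≋d

  reducible⇒segment : ∀ K → Reducible p (trinomial u v K) →
    ∃[ s ] ∃[ L ] s < 3 × 1 ≤ L × 3 ℕ.+ L ≤ K ℕ.* 3 × Mat.m11 (M (word s L)) ≈±1
  reducible⇒segment K (a₁ , amid , aₘ , b₁ , bmid , bₗ , 1≤|amid| , 1≤|bmid| , b-solution , sim)
    with rotation≋word K sim
  ... | s , c≋a⊕b with word-phase (suc (suc (length amid)) ℕ.+ s) (length bmid)
  ...   | s₀ , s₀<3 , phase = s₀ , length bmid , s₀<3 , 1≤|bmid| , bound ,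
          ≈±1-respˡ {Mat.m11 (M (word s₀ (length bmid)))}
            (proj₁ (M-cong (subst (_≋[ p ] bmid) (trans tail≡ phase) tail≋bmid)))
            (solution⇒inner-m11-≈±1 b₁ bmid bₗ b-solution)
    where
    n = K ℕ.* 3
    D = suc (suc (length amid))
    n≡ : n ≡ D ℕ.+ length bmid
    n≡ = begin
      n                                                ≡⟨ length-word s n ⟨
      length (word s n)                                ≡⟨ Pointwise-length c≋a⊕b ⟩
      suc (length (amid ++ (aₘ ℤ.+ b₁) ∷ bmid))        ≡⟨ cong suc (List.length-++ amid) ⟩
      suc (length amid ℕ.+ suc (length bmid))          ≡⟨ cong suc (ℕ.+-suc (length amid) (length bmid)) ⟩
      D ℕ.+ length bmid ∎
      where open ≡-Reasoning
    bound : 3 ℕ.+ length bmid ≤ n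
    bound = subst (3 ℕ.+ length bmid ≤_) (sym n≡) (s≤s (s≤s (ℕ.+-monoˡ-≤ (length bmid) 1≤|amid|)))
    tail≋bmid : drop D (word s n) ≋[ p ] bmid
    tail≋bmid = subst (drop D (word s n) ≋[ p ]_) (drop-++-∷ amid) (Pointwise-drop D c≋a⊕b)
    tail≡ : drop D (word s n) ≡ word (D ℕ.+ s) (length bmid)
    tail≡ = trans (drop-word D s n) (cong (word (D ℕ.+ s)) (trans (cong (_∸ D) n≡) (ℕ.m+n∸m≡n D (length bmid))))

^-distribʳ-* : ∀ x y n → (x * y) ^ n ≡ x ^ n * y ^ n
^-distribʳ-* x y zero    = refl
^-distribʳ-* x y (suc n) = trans (cong (x * y *_) (^-distribʳ-* x y n)) (interchange x y (x ^ n) (y ^ n))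
  where
  interchange : ∀ a b c d → a * b * (c * d) ≡ a * c * (b * d)
  interchange = solve-∀

RootAmongPowers : ℕ → ℤ → Set
RootAmongPowers p u = ∃[ j ] ∃[ ε ] ε ≈±1 × (let y = u * (- u) ^ j in y * y + ε * u * y ≈ + 1)
  where open Modular p

module Trinomial (p : ℕ) (u v : ℤ) (uv≈1 : Modular._≈_ p (u * v) (+ 1)) where
  open Modular p
  open PeriodicWord u v

  U V : ℤ
  U = - u
  V = - v

  ≈-modulo-uv : ∀ {x y} k → x - y ≡ k * (u * v - + 1) → x ≈ y
  ≈-modulo-uv {x} {y} k x-y≡ = x-y≈0⇒x≈y (begin
    x - y                 ≡⟨ x-y≡ ⟩
    k * (u * v - + 1)     ≈⟨ *-congˡ k (-cong uv≈1 (≈-refl {+ 1})) ⟩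
    k * (+ 1 - + 1)       ≡⟨ ℤ.*-zeroʳ k ⟩
    + 0 ∎)
    where open ≈-Reasoning

  UⁿVⁿ≈1 : ∀ n → U ^ n * V ^ n ≈ + 1
  UⁿVⁿ≈1 n = begin
    U ^ n * V ^ n   ≡⟨ ^-distribʳ-* U V n ⟨
    (U * V) ^ n     ≡⟨ cong (_^ n) (ℤ.neg-distribˡ-* u (- v)) ⟨
    (- (u * - v)) ^ n ≡⟨ cong (λ z → (- z) ^ n) (ℤ.neg-distribʳ-* u v) ⟨
    (- - (u * v)) ^ n ≡⟨ cong (_^ n) (ℤ.neg-involutive (u * v)) ⟩
    (u * v) ^ n     ≈⟨ ^-congˡ n uv≈1 ⟩
    (+ 1) ^ n       ≡⟨ ℤ.^-zeroˡ n ⟩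
    + 1 ∎
    where open ≈-Reasoning

  block : ℕ → Mat
  block 0 = mat U (+ 1 - v * v) (+ 0) V
  block 1 = mat U (+ 0) (v * v - + 1) V
  block _ = mat V (+ 0) (+ 0) U

  power : ℕ → ℕ → Mat
  power 0 j = mat (U ^ j) (v * (V ^ j - U ^ j)) (+ 0) (V ^ j)
  power 1 j = mat (U ^ j) (+ 0) (v * (U ^ j - V ^ j)) (V ^ j)
  power _ j = mat (V ^ j) (+ 0) (+ 0) (U ^ j)

  M-word-3 : ∀ s → s < 3 → M (word s 3) ≈ᴹ block s
  M-word-3 0 _ = ≈ᴹ-trans (≡⇒≈ᴹ (M-[x,y,z] u v v)) (≈-modulo-uv v (e₁₁ u v) , ≈-refl , ≈-modulo-uv (+ 1) (e₂₁ u v) , ≈-refl)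
    where
    e₁₁ : ∀ u v → ((v * v - + 1) * u - v) - - u ≡ v * (u * v - + 1)
    e₁₁ = solve-∀
    e₂₁ : ∀ u v → (v * u - + 1) - + 0 ≡ + 1 * (u * v - + 1)
    e₂₁ = solve-∀
  M-word-3 1 _ = ≈ᴹ-trans (≡⇒≈ᴹ (M-[x,y,z] v v u)) (≈-modulo-uv v (e₁₁ u v) , ≈-modulo-uv (- + 1) (e₁₂ u v) , ≈-refl , ≈-refl)
    where
    e₁₁ : ∀ u v → ((u * v - + 1) * v - u) - - u ≡ v * (u * v - + 1)
    e₁₁ = solve-∀
    e₁₂ : ∀ u v → (+ 1 - u * v) - + 0 ≡ - + 1 * (u * v - + 1)
    e₁₂ = solve-∀
  M-word-3 2 _ = ≈ᴹ-trans (≡⇒≈ᴹ (M-[x,y,z] v u v))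
    (≈-modulo-uv v (e₁₁ u v) , ≈-modulo-uv (- + 1) (e₁₂ u v) , ≈-modulo-uv (+ 1) (e₂₁ u v) , ≈-refl)
    where
    e₁₁ : ∀ u v → ((v * u - + 1) * v - v) - - v ≡ v * (u * v - + 1)
    e₁₁ = solve-∀
    e₁₂ : ∀ u v → (+ 1 - v * u) - + 0 ≡ - + 1 * (u * v - + 1)
    e₁₂ = solve-∀
    e₂₁ : ∀ u v → (u * v - + 1) - + 0 ≡ + 1 * (u * v - + 1)
    e₂₁ = solve-∀
  M-word-3 (suc (suc (suc _))) (s≤s (s≤s (s≤s ())))

  block·power : ∀ s j → s < 3 → block s · power s j ≈ᴹ power s (suc j)
  block·power 0 j _ =
    ≡⇒≈ (e₁₁ u v A) , ≈-modulo-uv (- B) (e₁₂ u v A B) , ≡⇒≈ (e₂₁ v A) , ≡⇒≈ (e₂₂ v A B)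
    where
    A = U ^ j
    B = V ^ j
    e₁₁ : ∀ u v A → - u * A + (+ 1 - v * v) * + 0 ≡ - u * A
    e₁₁ = solve-∀
    e₁₂ : ∀ u v A B → (- u * (v * (B - A)) + (+ 1 - v * v) * B) - v * (- v * B - - u * A) ≡ - B * (u * v - + 1)
    e₁₂ = solve-∀
    e₂₁ : ∀ v A → + 0 * A + - v * + 0 ≡ + 0
    e₂₁ = solve-∀
    e₂₂ : ∀ v A B → + 0 * (v * (B - A)) + - v * B ≡ - v * B
    e₂₂ = solve-∀
  block·power 1 j _ =
    ≡⇒≈ (e₁₁ u v A B) , ≡⇒≈ (e₁₂ u B) , ≈-modulo-uv A (e₂₁ u v A B) , ≡⇒≈ (e₂₂ v B)
    where
    A = U ^ j
    B = V ^ j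
    e₁₁ : ∀ u v A B → - u * A + + 0 * (v * (A - B)) ≡ - u * A
    e₁₁ = solve-∀
    e₁₂ : ∀ u B → - u * + 0 + + 0 * B ≡ + 0
    e₁₂ = solve-∀
    e₂₁ : ∀ u v A B → ((v * v - + 1) * A + - v * (v * (A - B))) - v * (- u * A - - v * B) ≡ A * (u * v - + 1)
    e₂₁ = solve-∀
    e₂₂ : ∀ v B → (v * v - + 1) * + 0 + - v * B ≡ - v * B
    e₂₂ = solve-∀
  block·power (suc (suc (suc _))) _ (s≤s (s≤s (s≤s ())))
  block·power 2 j _ = ≡⇒≈ (e₁₁ v B) , ≡⇒≈ (e₁₂ v A) , ≡⇒≈ (e₂₁ u B) , ≡⇒≈ (e₂₂ u A)
    where
    A = U ^ j
    B = V ^ j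
    e₁₁ : ∀ v B → - v * B + + 0 * + 0 ≡ - v * B
    e₁₁ = solve-∀
    e₁₂ : ∀ v A → - v * + 0 + + 0 * A ≡ + 0
    e₁₂ = solve-∀
    e₂₁ : ∀ u B → + 0 * B + - u * + 0 ≡ + 0
    e₂₁ = solve-∀
    e₂₂ : ∀ u A → + 0 * + 0 + - u * A ≡ - u * A
    e₂₂ = solve-∀

  M-word-*3 : ∀ s j → s < 3 → M (word s (j ℕ.* 3)) ≈ᴹ power s j
  M-word-*3 s (suc j) s<3 = ≈ᴹ-trans (≡⇒≈ᴹ split)
    (≈ᴹ-trans (·-cong (M-word-3 s s<3) (M-word-*3 s j s<3)) (block·power s j s<3))
    where
    split : M (word s (suc j ℕ.* 3)) ≡ M (word s 3) · M (word s (j ℕ.* 3))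
    split = trans (cong (λ L → M (word s L)) (ℕ.+-comm 3 (j ℕ.* 3))) (M-word-split s j 3)
  M-word-*3 0 zero _ = ≈-refl , ≡⇒≈ (sym (ℤ.*-zeroʳ v)) , ≈-refl , ≈-refl
  M-word-*3 1 zero _ = ≈-refl , ≈-refl , ≡⇒≈ (sym (ℤ.*-zeroʳ v)) , ≈-refl
  M-word-*3 2 zero _ = ≈ᴹ-refl
  M-word-*3 (suc (suc (suc _))) zero (s≤s (s≤s (s≤s ())))

  segment : ℕ → ℕ → ℕ → ℤ
  segment 0 0 j = U ^ j
  segment 0 1 j = u * U ^ j
  segment 0 2 j = + 0
  segment 1 0 j = U ^ j
  segment 1 1 j = v * V ^ j
  segment 1 2 j = v * v * V ^ j - U ^ j
  segment 2 0 j = V ^ j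
  segment 2 1 j = v * V ^ j
  segment _ _ j = + 0

  private
    rewriting : ∀ {N Q a c t} → N ≡ Q → Mat.m11 Q * a + Mat.m12 Q * c ≈ t → Mat.m11 N * a + Mat.m12 N * c ≈ t
    rewriting refl h = h

    first-column : ∀ s r j → s < 3 → r < 3 →
      Mat.m11 (M (word s r)) * Mat.m11 (power s j) + Mat.m12 (M (word s r)) * Mat.m21 (power s j) ≈ segment s r j
    first-column 0 0 j _ _ = ≡⇒≈ (e (U ^ j))
      where e : ∀ A → + 1 * A + + 0 * + 0 ≡ A
            e = solve-∀
    first-column 0 1 j _ _ = rewriting {c = + 0} (M-[x] u) (≡⇒≈ (e u (U ^ j)))
      where e : ∀ u A → u * A + - + 1 * + 0 ≡ u * A
            e = solve-∀
    first-column 0 2 j _ _ = rewriting (M-[x,y] u v) (≈-modulo-uv (U ^ j) (e u v (U ^ j)))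
      where e : ∀ u v A → ((v * u - + 1) * A + - v * + 0) - + 0 ≡ A * (u * v - + 1)
            e = solve-∀
    first-column 1 0 j _ _ = ≡⇒≈ (e v (U ^ j) (V ^ j))
      where e : ∀ v A B → + 1 * A + + 0 * (v * (A - B)) ≡ A
            e = solve-∀
    first-column 1 1 j _ _ = rewriting (M-[x] v) (≡⇒≈ (e v (U ^ j) (V ^ j)))
      where e : ∀ v A B → v * A + - + 1 * (v * (A - B)) ≡ v * B
            e = solve-∀
    first-column 1 2 j _ _ = rewriting (M-[x,y] v v) (≡⇒≈ (e v (U ^ j) (V ^ j)))
      where e : ∀ v A B → (v * v - + 1) * A + - v * (v * (A - B)) ≡ v * v * B - A
            e = solve-∀
    first-column 2 0 j _ _ = ≡⇒≈ (e (V ^ j))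
      where e : ∀ B → + 1 * B + + 0 * + 0 ≡ B
            e = solve-∀
    first-column 2 1 j _ _ = rewriting {c = + 0} (M-[x] v) (≡⇒≈ (e v (V ^ j)))
      where e : ∀ v B → v * B + - + 1 * + 0 ≡ v * B
            e = solve-∀
    first-column 2 2 j _ _ = rewriting (M-[x,y] v u) (≈-modulo-uv (V ^ j) (e u v (V ^ j)))
      where e : ∀ u v B → ((u * v - + 1) * B + - u * + 0) - + 0 ≡ B * (u * v - + 1)
            e = solve-∀
    first-column (suc (suc (suc _))) _ _ (s≤s (s≤s (s≤s ()))) _
    first-column _ (suc (suc (suc _))) _ _ (s≤s (s≤s (s≤s ())))

  m11-segment : ∀ s r j → s < 3 → r < 3 → Mat.m11 (M (word s (j ℕ.* 3 ℕ.+ r))) ≈ segment s r j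
  m11-segment s r j s<3 r<3 = begin
    m11 (M (word s (j ℕ.* 3 ℕ.+ r)))        ≡⟨ cong m11 (M-word-split s j r) ⟩
    m11 (M (word s r) · M (word s (j ℕ.* 3))) ≈⟨ +-cong (*-congˡ (m11 (M (word s r))) m11≈) (*-congˡ (m12 (M (word s r))) m21≈) ⟩
    m11 (M (word s r)) * m11 (power s j) + m12 (M (word s r)) * m21 (power s j) ≈⟨ first-column s r j s<3 r<3 ⟩
    segment s r j ∎
    where
    open Mat
    open ≈-Reasoning
    m11≈ = proj₁ (M-word-*3 s j s<3)
    m21≈ = proj₁ (proj₂ (proj₂ (M-word-*3 s j s<3)))

  Vⁿ≈±1⇒Uⁿ≈±1 : ∀ n → V ^ n ≈±1 → U ^ n ≈±1
  Vⁿ≈±1⇒Uⁿ≈±1 n = ≈±1-cancelʳ {U ^ n} (inj₁ (UⁿVⁿ≈1 n))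

  uUʲ≈±1⇒Uʲ⁺¹≈±1 : ∀ j → u * U ^ j ≈±1 → U ^ suc j ≈±1
  uUʲ≈±1⇒Uʲ⁺¹≈±1 j = -‿≈±1⁻ {U ^ suc j} ∘ subst _≈±1 (negate-twice u (U ^ j))
    where negate-twice : ∀ u A → u * A ≡ - (- u * A)
          negate-twice = solve-∀

  vVʲ≈±1⇒Uʲ⁺¹≈±1 : ∀ j → v * V ^ j ≈±1 → U ^ suc j ≈±1
  vVʲ≈±1⇒Uʲ⁺¹≈±1 j = Vⁿ≈±1⇒Uⁿ≈±1 (suc j) ∘ -‿≈±1⁻ {V ^ suc j} ∘ subst _≈±1 (negate-twice v (V ^ j))
    where negate-twice : ∀ v B → v * B ≡ - (- v * B)
          negate-twice = solve-∀

  segment≈±1-cases : Prime p → ∀ s r j → s < 3 → r < 3 → segment s r j ≈±1 →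
    (r ≡ 0 × U ^ j ≈±1) ⊎ (r ≡ 1 × U ^ suc j ≈±1) ⊎ RootAmongPowers p u
  segment≈±1-cases p-prime 0 0 j _ _ Uʲ≈±1  = inj₁ (refl , Uʲ≈±1)
  segment≈±1-cases p-prime 0 1 j _ _ uUʲ≈±1 = inj₂ (inj₁ (refl , uUʲ≈±1⇒Uʲ⁺¹≈±1 j uUʲ≈±1))
  segment≈±1-cases p-prime 0 2 j _ _ 0≈±1   = contradiction 0≈±1 (0≉±1 p-prime)
  segment≈±1-cases p-prime 1 0 j _ _ Uʲ≈±1  = inj₁ (refl , Uʲ≈±1)
  segment≈±1-cases p-prime 1 1 j _ _ vVʲ≈±1 = inj₂ (inj₁ (refl , vVʲ≈±1⇒Uʲ⁺¹≈±1 j vVʲ≈±1))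
  segment≈±1-cases p-prime 1 2 j _ _ D≈±1   = inj₂ (inj₂ (j , v * v * V ^ j - U ^ j , D≈±1 , (begin
    u * U ^ j * (u * U ^ j) + (v * v * V ^ j - U ^ j) * u * (u * U ^ j)  ≡⟨ expand u v (U ^ j) (V ^ j) ⟩
    (u * v) * (u * v) * (U ^ j * V ^ j)                                  ≈⟨ *-cong (*-cong uv≈1 uv≈1) (UⁿVⁿ≈1 j) ⟩
    + 1                                                                  ∎)))
    where open ≈-Reasoning
          expand : ∀ u v A B → u * A * (u * A) + (v * v * B - A) * u * (u * A) ≡ (u * v) * (u * v) * (A * B)
          expand = solve-∀
  segment≈±1-cases p-prime 2 0 j _ _ Vʲ≈±1  = inj₁ (refl , Vⁿ≈±1⇒Uⁿ≈±1 j Vʲ≈±1)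
  segment≈±1-cases p-prime 2 1 j _ _ vVʲ≈±1 = inj₂ (inj₁ (refl , vVʲ≈±1⇒Uʲ⁺¹≈±1 j vVʲ≈±1))
  segment≈±1-cases p-prime 2 2 j _ _ 0≈±1   = contradiction 0≈±1 (0≉±1 p-prime)
  segment≈±1-cases p-prime (suc (suc (suc _))) _ _ (s≤s (s≤s (s≤s ()))) _
  segment≈±1-cases p-prime _ (suc (suc (suc _))) _ _ (s≤s (s≤s (s≤s ())))

  m11-word≈±1-cases : Prime p → ∀ s L → s < 3 → 1 ≤ L → Mat.m11 (M (word s L)) ≈±1 →
    (∃[ e ] 1 ≤ e × e ℕ.* 3 ≤ 2 ℕ.+ L × U ^ e ≈±1) ⊎ RootAmongPowers p u
  m11-word≈±1-cases p-prime s L s<3 1≤L m11≈±1 = conclude (segment≈±1-cases p-prime s r j s<3 (m%n<n L 3)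
    (≈±1-respˡ {segment s r j} (≈-sym (m11-segment s r j s<3 (m%n<n L 3))) m11≈±1′))
    where
    j = L / 3
    r = L % 3
    L≡ : L ≡ j ℕ.* 3 ℕ.+ r
    L≡ = trans (m≡m%n+[m/n]*n L 3) (ℕ.+-comm r (j ℕ.* 3))
    m11≈±1′ : Mat.m11 (M (word s (j ℕ.* 3 ℕ.+ r))) ≈±1
    m11≈±1′ = subst (λ n → Mat.m11 (M (word s n)) ≈±1) L≡ m11≈±1
    conclude : (r ≡ 0 × U ^ j ≈±1) ⊎ (r ≡ 1 × U ^ suc j ≈±1) ⊎ RootAmongPowers p u →
               (∃[ e ] 1 ≤ e × e ℕ.* 3 ≤ 2 ℕ.+ L × U ^ e ≈±1) ⊎ RootAmongPowers p u
    conclude (inj₁ (r≡0 , Uʲ≈±1)) =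
      inj₁ (j , 1≤j (subst (1 ≤_) (trans L≡ (cong (j ℕ.* 3 ℕ.+_) r≡0)) 1≤L) , ℕ.≤-trans (m/n*n≤m L 3) (ℕ.m≤n+m L 2) , Uʲ≈±1)
      where 1≤j : ∀ {j} → 1 ≤ j ℕ.* 3 ℕ.+ 0 → 1 ≤ j
            1≤j {suc _} _ = s≤s z≤n
    conclude (inj₂ (inj₁ (r≡1 , Uʲ⁺¹≈±1))) =
      inj₁ (suc j , s≤s z≤n , ℕ.≤-reflexive (cong (2 ℕ.+_) 1+3j≡L) , Uʲ⁺¹≈±1)
      where 1+3j≡L : 1 ℕ.+ j ℕ.* 3 ≡ L
            1+3j≡L = trans (ℕ.+-comm 1 (j ℕ.* 3)) (sym (trans L≡ (cong (j ℕ.* 3 ℕ.+_) r≡1)))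
    conclude (inj₂ (inj₂ root)) = inj₂ root

  M-trinomial-≈ : ∀ e {c} → U ^ e ≈ c → c * c ≡ + 1 → M (trinomial u v e) ≈ᴹ mat c (+ 0) (+ 0) c
  M-trinomial-≈ e {c} Uᵉ≈c cc≡1 = ≈ᴹ-trans Mᵉ≈ (Uᵉ≈c , off-diagonal , ≈-refl , Vᵉ≈c)
    where
    Mᵉ≈ : M (trinomial u v e) ≈ᴹ power 0 e
    Mᵉ≈ = subst (λ w → M w ≈ᴹ power 0 e) (sym (trinomial≡word e)) (M-word-*3 0 e (s≤s z≤n))
    Vᵉ≈c : V ^ e ≈ c
    Vᵉ≈c = begin
      V ^ e                 ≡⟨ trans (sym (ℤ.*-identityˡ (V ^ e))) (cong (_* V ^ e) (sym cc≡1)) ⟩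
      c * c * V ^ e         ≈⟨ *-congʳ (V ^ e) (*-congˡ c (≈-sym Uᵉ≈c)) ⟩
      c * U ^ e * V ^ e     ≡⟨ ℤ.*-assoc c (U ^ e) (V ^ e) ⟩
      c * (U ^ e * V ^ e)   ≈⟨ *-congˡ c (UⁿVⁿ≈1 e) ⟩
      c * + 1               ≡⟨ ℤ.*-identityʳ c ⟩
      c ∎
      where open ≈-Reasoning
    off-diagonal : v * (V ^ e - U ^ e) ≈ + 0
    off-diagonal = begin
      v * (V ^ e - U ^ e)   ≈⟨ *-congˡ v (-cong Vᵉ≈c Uᵉ≈c) ⟩
      v * (c - c)           ≡⟨ trans (cong (v *_) (ℤ.+-inverseʳ c)) (ℤ.*-zeroʳ v) ⟩
      + 0 ∎
      where open ≈-Reasoning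

  trinomial-solution : ∀ e → U ^ e ≈±1 → Solution p (trinomial u v e)
  trinomial-solution e (inj₁ Uᵉ≈1)  = inj₁ (≈ᴹ⇒≈[] (M-trinomial-≈ e Uᵉ≈1 refl))
  trinomial-solution e (inj₂ Uᵉ≈-1) = inj₂ (≈ᴹ⇒≈[] (M-trinomial-≈ e Uᵉ≈-1 refl))

module _ {p : ℕ} where
  open Modular p

  minimal-irreducible : Prime p → ∀ {u} → ¬ RootAmongPowers p u → MinimalIrreducible p u
  minimal-irreducible p-prime {u} ¬root v k (uv≡1 , 1≤k , solution , minimal) = solution , 3≤length , irreducible
    where
    open PeriodicWord u v
    open Trinomial p u v (≡[]⇒≈ uv≡1)
    3≤length : 3 ≤ length (trinomial u v k)
    3≤length = subst (3 ≤_) (sym (trans (cong length (trinomial≡word k)) (length-word 0 (k ℕ.* 3)))) (ℕ.*-monoˡ-≤ 3 1≤k)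
    irreducible : ¬ Reducible p (trinomial u v k)
    irreducible reducible with reducible⇒segment p u v k reducible
    ... | s , L , s<3 , 1≤L , 3+L≤k*3 , m11≈±1 =
      [ smaller-solution , ¬root ]′ (m11-word≈±1-cases p-prime s L s<3 1≤L m11≈±1)
      where
      smaller-solution : ¬ (∃[ e ] 1 ≤ e × e ℕ.* 3 ≤ 2 ℕ.+ L × U ^ e ≈±1)
      smaller-solution (e , 1≤e , e*3≤2+L , Uᵉ≈±1) =
        minimal e 1≤e (ℕ.*-cancelʳ-< 3 e k (ℕ.<-≤-trans (s≤s e*3≤2+L) 3+L≤k*3)) (trinomial-solution e Uᵉ≈±1)

module _ {p : ℕ} where
  open Modular p

  private
    completed-square : ∀ u y ε → (+ 2 * y + ε * u) * (+ 2 * y + ε * u) ≡ + 4 * (y * y + ε * u * y) + ε * ε * (u * u)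
    completed-square = solve-∀

    root⇒square : ∀ {u y ε} → ε ≈±1 → y * y + ε * u * y ≈ + 1 → (+ 2 * y + ε * u) * (+ 2 * y + ε * u) ≈ u * u + + 4
    root⇒square {u} {y} {ε} ε≈±1 root = begin
      (+ 2 * y + ε * u) * (+ 2 * y + ε * u)           ≡⟨ completed-square u y ε ⟩
      + 4 * (y * y + ε * u * y) + ε * ε * (u * u)     ≈⟨ +-cong (*-congˡ (+ 4) root) (*-congʳ (u * u) (≈±1-square ε≈±1)) ⟩
      + 4 * + 1 + + 1 * (u * u)                       ≡⟨ cong (_+_ (+ 4)) (ℤ.*-identityˡ (u * u)) ⟩
      + 4 + u * u                                     ≡⟨ ℤ.+-comm (+ 4) (u * u) ⟩
      u * u + + 4 ∎
      where open ≈-Reasoning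

  nonsquare⇒¬RootAmongPowers : ∀ {u} → ¬ IsSquare (u * u + + 4) → ¬ RootAmongPowers p u
  nonsquare⇒¬RootAmongPowers {u} ¬square (j , ε , ε≈±1 , root) =
    ¬square (+ 2 * (u * (- u) ^ j) + ε * u , root⇒square {u} {u * (- u) ^ j} ε≈±1 root)

  discriminant≈0⇒¬RootAmongPowers : Prime p → ∀ {u} → u * u + + 4 ≈ + 0 → ¬ u ≈ + 0 →
    ∀ e → (- u) ^ e ≈±1 → ¬ (+ 2) ^ e ≈±1 → ¬ RootAmongPowers p u
  discriminant≈0⇒¬RootAmongPowers p-prime {u} Δ≈0 u≉0 e [-u]ᵉ≈±1 2ᵉ≉±1 (j , ε , ε≈±1 , root) =
    2ᵉ≉±1 (≈±1-cancelʳ {(+ 2) ^ e} (subst _≈±1 (^-distribʳ-* (+ 2) A e) [2A]ᵉ≈±1) Aᵉ≈±1)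
    where
    A = (- u) ^ j
    y = u * A
    2y+εu≈0 : + 2 * y + ε * u ≈ + 0
    2y+εu≈0 = ≈0-square p-prime (≈-trans (root⇒square {u} {y} ε≈±1 root) Δ≈0)
    2A+ε≈0 : + 2 * A + ε ≈ + 0
    2A+ε≈0 = [ (λ u≈0 → contradiction u≈0 u≉0) , id ]′ (≈0-product p-prime (≈-trans (≡⇒≈ (factor u A ε)) 2y+εu≈0))
      where factor : ∀ u A ε → u * (+ 2 * A + ε) ≡ + 2 * (u * A) + ε * u
            factor = solve-∀
    2A≈-ε : + 2 * A ≈ - ε
    2A≈-ε = begin
      + 2 * A             ≡⟨ shift (+ 2 * A) ε ⟩
      (+ 2 * A + ε) - ε   ≈⟨ -cong 2A+ε≈0 (≈-refl {ε}) ⟩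
      + 0 - ε             ≡⟨ ℤ.+-identityˡ (- ε) ⟩
      - ε ∎
      where open ≈-Reasoning
            shift : ∀ x ε → x ≡ (x + ε) - ε
            shift = solve-∀
    [2A]ᵉ≈±1 : (+ 2 * A) ^ e ≈±1
    [2A]ᵉ≈±1 = ≈±1-^ e (≈±1-respˡ {+ 2 * A} 2A≈-ε (-‿≈±1 ε≈±1))
    Aᵉ≈±1 : A ^ e ≈±1
    Aᵉ≈±1 = subst _≈±1 (trans (ℤ.^-*-assoc (- u) e j) (trans (cong ((- u) ^_) (ℕ.*-comm e j)) (sym (ℤ.^-*-assoc (- u) j e))))
                       (≈±1-^ j [-u]ᵉ≈±1)

injective⇒surjective : ∀ {n} {f : Fin n → Fin n} → Injective _≡_ _≡_ f → ∀ y → ∃[ x ] f x ≡ y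
injective⇒surjective {suc n} {f} f-injective y with Fin.any? (λ x → f x Fin.≟ y)
... | yes found  = found
... | no  ∉image = contradiction (Fin.injective⇒≤ punched-injective) ℕ.1+n≰n
  where
  punched : Fin (suc n) → Fin n
  punched x = Fin.punchOut {i = y} {j = f x} (λ y≡fx → ∉image (x , sym y≡fx))
  punched-injective : Injective _≡_ _≡_ punched
  punched-injective {x} {x′} eq =
    f-injective (Fin.punchOut-injective (λ y≡fx → ∉image (x , sym y≡fx)) (λ y≡fx′ → ∉image (x′ , sym y≡fx′)) eq)

injective⇒permutation : ∀ {n} {f : Fin n → Fin n} → Injective _≡_ _≡_ f → Permutation′ n
injective⇒permutation {f = f} f-injective =
  permutation f (proj₁ ∘ surjective) (proj₂ ∘ surjective) (λ x → f-injective (proj₂ (surjective (f x))))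
  where surjective = injective⇒surjective f-injective

sign : ℕ → ℤ
sign k = (- + 1) ^ k

sign≡±1 : ∀ k → sign k ≡ + 1 ⊎ sign k ≡ - + 1
sign≡±1 zero    = inj₁ refl
sign≡±1 (suc k) with sign≡±1 k
... | inj₁ eq = inj₂ (cong (_*_ (- + 1)) eq)
... | inj₂ eq = inj₁ (cong (_*_ (- + 1)) eq)

sign-square : ∀ k → sign k * sign k ≡ + 1
sign-square k with sign≡±1 k
... | inj₁ eq = cong₂ _*_ eq eq
... | inj₂ eq = cong₂ _*_ eq eq

sign[k*2]≡1 : ∀ k → sign (k ℕ.* 2) ≡ + 1
sign[k*2]≡1 k = trans (sym (ℤ.^-*-assoc (- + 1) k 2)) (trans (cong (sign k *_) (ℤ.*-identityʳ (sign k))) (sign-square k))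

sign-parity : ∀ n → sign n ≡ sign (n % 2)
sign-parity n = begin
  sign n                               ≡⟨ cong sign (m≡m%n+[m/n]*n n 2) ⟩
  sign (n % 2 ℕ.+ n / 2 ℕ.* 2)         ≡⟨ ℤ.^-distribˡ-+-* (- + 1) (n % 2) (n / 2 ℕ.* 2) ⟩
  sign (n % 2) * sign (n / 2 ℕ.* 2)    ≡⟨ cong (sign (n % 2) *_) (sign[k*2]≡1 (n / 2)) ⟩
  sign (n % 2) * + 1                   ≡⟨ ℤ.*-identityʳ (sign (n % 2)) ⟩
  sign (n % 2) ∎
  where open ≡-Reasoning

-- By nonsquare-by-residue, a = suc b is a quadratic non-residue modulo every prime p ≡ r (mod 4a) with p ∤ a.
NonresidueClass : ℕ → ℕ → Set
NonresidueClass b r = (b ℕ.* (r / 2) ℕ.+ lowerCount b r) % 2 ≡ 1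

ResidueTable : ℕ → (ℕ → Set) → Set
ResidueTable b P = ∀ (r : Fin (4 ℕ.* suc b)) → toℕ r % 2 ≡ 1 → P (toℕ r) → NonresidueClass b (toℕ r)

residueTable? : ∀ b {P} → Decidable P → Dec (ResidueTable b P)
residueTable? b P? = Fin.all? λ r → (toℕ r % 2 ≟ 1) →-dec (P? (toℕ r) →-dec (_ ≟ 1))

module GaussLemma (h : ℕ) (p-prime : Prime (suc (2 ℕ.* h))) where
  p : ℕ
  p = suc (2 ℕ.* h)
  open Modular p

  private
    2h<p : 2 ℕ.* h < p
    2h<p = ℕ.n<1+n (2 ℕ.* h)

    small-multiple : ∀ {d} → p ℕ.∣ d → d < p → d ≡ 0
    small-multiple {zero}  _   _   = refl
    small-multiple {suc _} p∣d d<p = contradiction p∣d (ℕ.>⇒∤ d<p)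

  absResidue : ℕ → ℕ
  absResidue n with n % p ≤? h
  ... | yes _ = n % p
  ... | no  _ = p ∸ n % p

  double-quotient : ∀ n → (2 ℕ.* n) / p ≡ (2 ℕ.* (n % p)) / p ℕ.+ n / p ℕ.* 2
  double-quotient n = begin
    (2 ℕ.* n) / p                              ≡⟨ cong (λ m → (2 ℕ.* m) / p) (m≡m%n+[m/n]*n n p) ⟩
    (2 ℕ.* (n % p ℕ.+ n / p ℕ.* p)) / p         ≡⟨ cong (_/ p) (distribute (n % p) (n / p) p) ⟩
    (2 ℕ.* (n % p) ℕ.+ n / p ℕ.* 2 ℕ.* p) / p   ≡⟨ [m+kn]/n≡m/n+k (2 ℕ.* (n % p)) (n / p ℕ.* 2) p ⟩
    (2 ℕ.* (n % p)) / p ℕ.+ n / p ℕ.* 2         ∎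
    where open ≡-Reasoning
          distribute : ∀ r t p → 2 ℕ.* (r ℕ.+ t ℕ.* p) ≡ 2 ℕ.* r ℕ.+ t ℕ.* 2 ℕ.* p
          distribute = ℕ-Solver.solve-∀

  double-quotient-small : ∀ n → n % p ≤ h → (2 ℕ.* n) / p ≡ n / p ℕ.* 2
  double-quotient-small n ρ≤h =
    trans (double-quotient n) (cong (ℕ._+ n / p ℕ.* 2) (m<n⇒m/n≡0 (ℕ.≤-<-trans (ℕ.*-monoʳ-≤ 2 ρ≤h) 2h<p)))

  double-quotient-large : ∀ n → h < n % p → (2 ℕ.* n) / p ≡ suc (n / p ℕ.* 2)
  double-quotient-large n h<ρ = begin
    (2 ℕ.* n) / p                          ≡⟨ double-quotient n ⟩
    (2 ℕ.* ρ) / p ℕ.+ n / p ℕ.* 2          ≡⟨ cong (ℕ._+ n / p ℕ.* 2) (trans (m/n≡1+[m∸n]/n p≤2ρ) (cong suc (m<n⇒m/n≡0 2ρ∸p<p))) ⟩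
    suc (n / p ℕ.* 2) ∎
    where
    open ≡-Reasoning
    ρ = n % p
    p≤2ρ : p ≤ 2 ℕ.* ρ
    p≤2ρ = ℕ.≤-trans (ℕ.n≤1+n p) (ℕ.≤-trans (ℕ.≤-reflexive (double-suc h)) (ℕ.*-monoʳ-≤ 2 h<ρ))
      where double-suc : ∀ h → suc (suc (2 ℕ.* h)) ≡ 2 ℕ.* suc h
            double-suc = ℕ-Solver.solve-∀
    2ρ∸p<p : 2 ℕ.* ρ ∸ p < p
    2ρ∸p<p = ℕ.m<n+o⇒m∸n<o (2 ℕ.* ρ) p (ℕ.<-≤-trans (ℕ.*-monoʳ-< 2 (m%n<n n p)) (ℕ.≤-reflexive (double p)))
      where double : ∀ p → 2 ℕ.* p ≡ p ℕ.+ p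
            double = ℕ-Solver.solve-∀

  complement-multiple : ∀ n → n ℕ.+ (p ∸ n % p) ≡ suc (n / p) ℕ.* p
  complement-multiple n = begin
    n ℕ.+ (p ∸ ρ)                          ≡⟨ cong (ℕ._+ (p ∸ ρ)) (m≡m%n+[m/n]*n n p) ⟩
    ρ ℕ.+ n / p ℕ.* p ℕ.+ (p ∸ ρ)          ≡⟨ swap ρ (n / p ℕ.* p) (p ∸ ρ) ⟩
    n / p ℕ.* p ℕ.+ (ρ ℕ.+ (p ∸ ρ))        ≡⟨ cong (n / p ℕ.* p ℕ.+_) (ℕ.m+[n∸m]≡n (ℕ.<⇒≤ (m%n<n n p))) ⟩
    n / p ℕ.* p ℕ.+ p                      ≡⟨ ℕ.+-comm (n / p ℕ.* p) p ⟩
    suc (n / p) ℕ.* p ∎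
    where
    open ≡-Reasoning
    ρ = n % p
    swap : ∀ a b c → a ℕ.+ b ℕ.+ c ≡ b ℕ.+ (a ℕ.+ c)
    swap = ℕ-Solver.solve-∀

  residue-sign : ∀ n → + n ≈ sign ((2 ℕ.* n) / p) ℤ.* + absResidue n
  residue-sign n with n % p ≤? h
  ... | yes ρ≤h = begin
    + n                                        ≈⟨ ≈-remainder (n / p) (m≡m%n+[m/n]*n n p) ⟩
    + (n % p)                                  ≡⟨ ℤ.*-identityˡ (+ (n % p)) ⟨
    + 1 * + (n % p)                            ≡⟨ cong (_* + (n % p)) (trans (sym (sign[k*2]≡1 (n / p)))
                                                                                 (cong sign (sym (double-quotient-small n ρ≤h)))) ⟩
    sign ((2 ℕ.* n) / p) * + (n % p) ∎
    where open ≈-Reasoning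
  ... | no  ρ≰h = begin
    + n                                        ≈⟨ ≈-multiple (+ suc (n / p)) difference ⟩
    - + (p ∸ n % p)                            ≡⟨ ℤ.-1*i≡-i (+ (p ∸ n % p)) ⟨
    - + 1 * + (p ∸ n % p)                      ≡⟨ cong (_* + (p ∸ n % p)) (trans (cong (_*_ (- + 1)) (sym (sign[k*2]≡1 (n / p))))
                                                                                  (cong sign (sym (double-quotient-large n (ℕ.≰⇒> ρ≰h))))) ⟩
    sign ((2 ℕ.* n) / p) * + (p ∸ n % p) ∎
    where
    open ≈-Reasoning
    difference : + n - - + (p ∸ n % p) ≡ + suc (n / p) * + p
    difference = trans (cong (_+_ (+ n)) (ℤ.neg-involutive (+ (p ∸ n % p))))
      (trans (sym (ℤ.pos-+ n (p ∸ n % p))) (trans (cong +_ (complement-multiple n)) (ℤ.pos-* (suc (n / p)) p)))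

  absResidue-bounds : ∀ n → ¬ p ℕ.∣ n → 1 ≤ absResidue n × absResidue n ≤ h
  absResidue-bounds n p∤n with n % p ≤? h
  ... | yes ρ≤h = ℕ.n≢0⇒n>0 (λ ρ≡0 → p∤n (ℕ.m%n≡0⇒n∣m n p ρ≡0)) , ρ≤h
  ... | no  ρ≰h = ℕ.m<n⇒0<n∸m (m%n<n n p) , ℕ.≤-trans (ℕ.∸-monoʳ-≤ p (ℕ.≰⇒> ρ≰h)) (ℕ.≤-reflexive p∸[h+1]≡h)
    where p∸[h+1]≡h : p ∸ suc h ≡ h
          p∸[h+1]≡h = trans (ℕ.m+n∸m≡n h (h ℕ.+ 0)) (ℕ.+-identityʳ h)

  private
    ≈-small : ∀ {a b} → a ≤ h → b ≤ h → + a ≈ + b → a ≡ b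
    ≈-small {a} {b} a≤h b≤h a≈b =
      ℤ.+-injective (ℤ.i-j≡0⇒i≡j (+ a) (+ b) (ℤ.∣i∣≡0⇒i≡0 (small-multiple (≈⇒≡[] a≈b) ∣a-b∣<p)))
      where
      ∣a-b∣<p : ℤ.∣ + a - + b ∣ < p
      ∣a-b∣<p = ℕ.≤-<-trans (subst (_≤ a ℕ.⊔ b) (cong ℤ.∣_∣ (sym (ℤ.m-n≡m⊖n a b))) (ℤ.∣m⊝n∣≤m⊔n a b))
                            (ℕ.≤-<-trans (ℕ.⊔-lub a≤h b≤h) (ℕ.≤-<-trans (ℕ.m≤m+n h (h ℕ.+ 0)) 2h<p))

    ≉-small-opposite : ∀ {a b} → 1 ≤ a → a ≤ h → b ≤ h → ¬ + a ≈ - + b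
    ≉-small-opposite {suc a} {b} _ a≤h b≤h a≈-b = contradiction (small-multiple p∣a+b a+b<p) λ ()
      where
      p∣a+b : p ℕ.∣ suc a ℕ.+ b
      p∣a+b = subst (λ z → p ℕ.∣ ℤ.∣ z ∣) (trans (cong (_+_ (+ suc a)) (ℤ.neg-involutive (+ b))) (sym (ℤ.pos-+ (suc a) b)))
                    (≈⇒≡[] a≈-b)
      a+b<p : suc a ℕ.+ b < p
      a+b<p = ℕ.≤-<-trans (ℕ.+-mono-≤ a≤h (ℕ.≤-trans b≤h (ℕ.m≤m+n h 0))) 2h<p

    signs-agree : ∀ {a b} ε δ → 1 ≤ a → a ≤ h → 1 ≤ b → b ≤ h →
      ε ≡ + 1 ⊎ ε ≡ - + 1 → δ ≡ + 1 ⊎ δ ≡ - + 1 → ε * + a ≈ δ * + b → a ≡ b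
    signs-agree {a} {b} _ _ _ a≤h _ b≤h (inj₁ refl) (inj₁ refl) εa≈δb =
      ≈-small a≤h b≤h (subst₂ _≈_ (ℤ.*-identityˡ (+ a)) (ℤ.*-identityˡ (+ b)) εa≈δb)
    signs-agree {a} {b} _ _ _ a≤h _ b≤h (inj₂ refl) (inj₂ refl) εa≈δb =
      ≈-small a≤h b≤h (subst₂ _≈_ (ℤ.neg-involutive (+ a)) (ℤ.neg-involutive (+ b))
        (-‿cong (subst₂ _≈_ (ℤ.-1*i≡-i (+ a)) (ℤ.-1*i≡-i (+ b)) εa≈δb)))
    signs-agree {a} {b} _ _ 1≤a a≤h _ b≤h (inj₁ refl) (inj₂ refl) εa≈δb =
      contradiction (subst₂ _≈_ (ℤ.*-identityˡ (+ a)) (ℤ.-1*i≡-i (+ b)) εa≈δb) (≉-small-opposite 1≤a a≤h b≤h)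
    signs-agree {a} {b} _ _ _ a≤h 1≤b b≤h (inj₂ refl) (inj₁ refl) εa≈δb =
      contradiction (≈-sym (subst₂ _≈_ (ℤ.-1*i≡-i (+ a)) (ℤ.*-identityˡ (+ b)) εa≈δb)) (≉-small-opposite 1≤b b≤h a≤h)

  absResidue-injective : ∀ {x} → ¬ p ℕ.∣ x → ∀ {a b} → 1 ≤ a → a ≤ h → 1 ≤ b → b ≤ h →
    absResidue (x ℕ.* a) ≡ absResidue (x ℕ.* b) → a ≡ b
  absResidue-injective {x} p∤x {a} {b} 1≤a a≤h 1≤b b≤h R≡R =
    signs-agree (sign (e a)) (sign (e b)) 1≤a a≤h 1≤b b≤h (sign≡±1 (e a)) (sign≡±1 (e b)) (*-cancelˡ p-prime x≉0 (begin
      + x * (sign (e a) * + a)    ≡⟨ move (+ x) (sign (e a)) (+ a) ⟩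
      sign (e a) * (+ x * + a)    ≈⟨ unsign a ⟩
      + absResidue (x ℕ.* a)      ≡⟨ cong +_ R≡R ⟩
      + absResidue (x ℕ.* b)      ≈⟨ unsign b ⟨
      sign (e b) * (+ x * + b)    ≡⟨ move (+ x) (sign (e b)) (+ b) ⟨
      + x * (sign (e b) * + b)    ∎))
    where
    open ≈-Reasoning
    e : ℕ → ℕ
    e c = (2 ℕ.* (x ℕ.* c)) / p
    x≉0 : ¬ + x ≈ + 0
    x≉0 x≈0 = p∤x (≈0⇒∣ x≈0)
    move : ∀ x ε a → x * (ε * a) ≡ ε * (x * a)
    move = solve-∀
    unsign : ∀ c → sign (e c) * (+ x * + c) ≈ + absResidue (x ℕ.* c)
    unsign c = begin
      sign (e c) * (+ x * + c)                          ≡⟨ cong (sign (e c) *_) (ℤ.pos-* x c) ⟨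
      sign (e c) * + (x ℕ.* c)                          ≈⟨ *-congˡ (sign (e c)) (residue-sign (x ℕ.* c)) ⟩
      sign (e c) * (sign (e c) * + absResidue (x ℕ.* c)) ≡⟨ ℤ.*-assoc (sign (e c)) (sign (e c)) _ ⟨
      sign (e c) * sign (e c) * + absResidue (x ℕ.* c)   ≡⟨ cong (_* + absResidue (x ℕ.* c)) (sign-square (e c)) ⟩
      + 1 * + absResidue (x ℕ.* c)                      ≡⟨ ℤ.*-identityˡ _ ⟩
      + absResidue (x ℕ.* c) ∎

  private
    module Π = Algebra.Properties.CommutativeMonoid.Sum *-commutativeMonoid

    ∏-const : ∀ n c → Π.sum {n} (λ _ → c) ≡ c ^ n
    ∏-const zero    c = refl
    ∏-const (suc n) c = cong (c *_) (∏-const n c)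

    ∏-sign : ∀ n (c : Fin n → ℕ) → Π.sum (λ i → sign (c i)) ≡ sign (∑[ i < n ] c i)
    ∏-sign zero    c = refl
    ∏-sign (suc n) c = trans (cong (sign (c Fin.zero) *_) (∏-sign n (c ∘ Fin.suc)))
                             (sym (ℤ.^-distribˡ-+-* (- + 1) (c Fin.zero) (∑[ i < n ] c (Fin.suc i))))

    ∏-nonzero : ∀ n (f : Fin n → ℤ) → (∀ i → ¬ f i ≈ + 0) → ¬ Π.sum f ≈ + 0
    ∏-nonzero zero    f _       1≈0 = 0≉±1 p-prime (inj₁ (≈-sym 1≈0))
    ∏-nonzero (suc n) f f≉0 ∏f≈0 =
      [ f≉0 Fin.zero , ∏-nonzero n (f ∘ Fin.suc) (f≉0 ∘ Fin.suc) ]′ (≈0-product p-prime ∏f≈0)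

    p∤small : ∀ {n} → 1 ≤ n → n ≤ h → ¬ p ℕ.∣ n
    p∤small {suc n} _ n<h = ℕ.>⇒∤ (ℕ.≤-<-trans n<h (ℕ.≤-<-trans (ℕ.m≤m+n h (h ℕ.+ 0)) 2h<p))

    toFin : ∀ {m} → 1 ≤ m → m ≤ h → Fin h
    toFin {suc m} _ m<h = fromℕ< m<h

    suc-toℕ-toFin : ∀ {m} (1≤m : 1 ≤ m) (m≤h : m ≤ h) → suc (toℕ (toFin 1≤m m≤h)) ≡ m
    suc-toℕ-toFin {suc m} _ m<h = cong suc (Fin.toℕ-fromℕ< m<h)

  gauss-lemma : ∀ x → ¬ p ℕ.∣ x → (+ x) ^ h ≈ sign (gaussExponent h x)
  gauss-lemma x p∤x = *-cancelʳ p-prime ∏n≉0 (begin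
    (+ x) ^ h * ∏n                                  ≡⟨ cong (_* ∏n) (∏-const h (+ x)) ⟨
    Π.sum {h} (λ _ → + x) * ∏n                      ≈⟨ Π.∑-distrib-+ {h} (λ _ → + x) (λ i → + n i) ⟨
    Π.sum (λ i → + x * + n i)                       ≈⟨ Π.sum-cong-≋ {h} folded ⟩
    Π.sum (λ i → sign (c i) * + n (g i))            ≈⟨ Π.∑-distrib-+ {h} (λ i → sign (c i)) (λ i → + n (g i)) ⟩
    Π.sum (λ i → sign (c i)) * Π.sum (λ i → + n (g i))
                                                    ≈⟨ *-cong (≡⇒≈ (∏-sign h c)) (≈-sym (Π.sum-permute (λ i → + n i) (injective⇒permutation g-injective))) ⟩
    sign (∑[ i < h ] c i) * ∏n                      ≡⟨ cong (λ e → sign e * ∏n) exponent ⟩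
    sign (gaussExponent h x) * ∏n ∎)
    where
    open ≈-Reasoning
    n : Fin h → ℕ
    n i = suc (toℕ i)
    c : Fin h → ℕ
    c i = (2 ℕ.* (x ℕ.* n i)) / p
    ∏n = Π.sum (λ i → + n i)
    ∏n≉0 : ¬ ∏n ≈ + 0
    ∏n≉0 = ∏-nonzero h (λ i → + n i) (λ i n≈0 → p∤small (s≤s z≤n) (Fin.toℕ<n i) (≈0⇒∣ n≈0))
    p∤xn : ∀ i → ¬ p ℕ.∣ x ℕ.* n i
    p∤xn i p∣xn = [ p∤x , p∤small (s≤s z≤n) (Fin.toℕ<n i) ]′ (euclidsLemma x (n i) p-prime p∣xn)
    g : Fin h → Fin h
    g i = let 1≤R , R≤h = absResidue-bounds (x ℕ.* n i) (p∤xn i) in toFin 1≤R R≤h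
    n∘g : ∀ i → n (g i) ≡ absResidue (x ℕ.* n i)
    n∘g i = let 1≤R , R≤h = absResidue-bounds (x ℕ.* n i) (p∤xn i) in suc-toℕ-toFin 1≤R R≤h
    g-injective : Injective _≡_ _≡_ g
    g-injective {i} {j} gi≡gj = Fin.toℕ-injective (ℕ.suc-injective
      (absResidue-injective p∤x (s≤s z≤n) (Fin.toℕ<n i) (s≤s z≤n) (Fin.toℕ<n j)
        (trans (sym (n∘g i)) (trans (cong (suc ∘ toℕ) gi≡gj) (n∘g j)))))
    folded : ∀ i → + x * + n i ≈ sign (c i) * + n (g i)
    folded i = begin
      + x * + n i                          ≡⟨ ℤ.pos-* x (n i) ⟨
      + (x ℕ.* n i)                        ≈⟨ residue-sign (x ℕ.* n i) ⟩
      sign (c i) * + absResidue (x ℕ.* n i) ≡⟨ cong (λ m → sign (c i) * + m) (n∘g i) ⟨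
      sign (c i) * + n (g i)               ∎
    exponent : ∑[ i < h ] c i ≡ gaussExponent h x
    exponent = sum-cong-≋ {h} λ i → cong (_/ p) (swap x (n i))
      where swap : ∀ x n → 2 ℕ.* (x ℕ.* n) ≡ n ℕ.* (2 ℕ.* x)
            swap = ℕ-Solver.solve-∀

  1≉-1 : ¬ + 1 ≈ - + 1
  1≉-1 1≈-1 = ¬prime[1] (subst Prime (h≡0⇒p≡1 (ℕ.n<1⇒n≡0 (ℕ.*-cancelˡ-< 2 h 1 (ℕ.∣⇒≤ (≈⇒≡[] 1≈-1))))) p-prime)
    where h≡0⇒p≡1 : h ≡ 0 → p ≡ 1
          h≡0⇒p≡1 refl = refl

  pow-half≈±1 : ∀ {w} → ¬ w ≈ + 0 → w ^ h ≈±1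
  pow-half≈±1 {w} w≉0 = ≈±1-respˡ {w ^ h} (≈-trans (^-congˡ h w≈r) (gauss-lemma r p∤r)) (sign-≈±1 (gaussExponent h r))
    where
    r = w ℤ.%ℕ p
    w≈r : w ≈ + r
    w≈r = ≈-multiple (w ℤ./ℕ p) (trans (cong (_- + r) (a≡a%ℕn+[a/ℕn]*n w p)) (cancel (+ r) _))
      where cancel : ∀ r x → r + x - r ≡ x
            cancel = solve-∀
    p∤r : ¬ p ℕ.∣ r
    p∤r p∣r = w≉0 (≈-trans w≈r (∣⇒≈0 p∣r))
    sign-≈±1 : ∀ k → sign k ≈±1
    sign-≈±1 k = Data.Sum.map ≡⇒≈ ≡⇒≈ (sign≡±1 k)

  square⇒pow-half≈1 : ∀ {c} → IsSquare c → ¬ c ≈ + 0 → c ^ h ≈ + 1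
  square⇒pow-half≈1 {c} (w , ww≈c) c≉0 = begin
    c ^ h               ≈⟨ ^-congˡ h ww≈c ⟨
    (w * w) ^ h         ≡⟨ ^-distribʳ-* w w h ⟩
    w ^ h * w ^ h       ≈⟨ ≈±1-square (pow-half≈±1 w≉0) ⟩
    + 1 ∎
    where
    open ≈-Reasoning
    w≉0 : ¬ w ≈ + 0
    w≉0 w≈0 = c≉0 (≈-trans (≈-sym ww≈c) (*-cong w≈0 w≈0))

  nonsquare-by-parity : ∀ a → ¬ p ℕ.∣ a → gaussExponent h a % 2 ≡ 1 → ¬ IsSquare (+ a)
  nonsquare-by-parity a p∤a odd square = 1≉-1 (begin
    + 1                        ≈⟨ square⇒pow-half≈1 square (λ a≈0 → p∤a (≈0⇒∣ a≈0)) ⟨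
    (+ a) ^ h                  ≈⟨ gauss-lemma a p∤a ⟩
    sign (gaussExponent h a)   ≡⟨ trans (sign-parity (gaussExponent h a)) (cong sign odd) ⟩
    - + 1 ∎)
    where open ≈-Reasoning

  p%2≡1 : p % 2 ≡ 1
  p%2≡1 = trans (cong (λ t → suc t % 2) (ℕ.*-comm 2 h)) ([m+kn]%n≡m%n 1 h 2)

  p%4a%2≡1 : ∀ b → p % (4 ℕ.* suc b) % 2 ≡ 1
  p%4a%2≡1 b = trans (m∣n⇒o%n%m≡o%m 2 (4 ℕ.* suc b) p (ℕ.divides (2 ℕ.* suc b) (double-double (suc b)))) p%2≡1
    where double-double : ∀ a → 4 ℕ.* a ≡ 2 ℕ.* a ℕ.* 2
          double-double = ℕ-Solver.solve-∀

  nonsquare-by-residue : ∀ b → ¬ p ℕ.∣ suc b → NonresidueClass b (p % (4 ℕ.* suc b)) → ¬ IsSquare (+ suc b)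
  nonsquare-by-residue b p∤a odd = nonsquare-by-parity (suc b) p∤a (begin
    gaussExponent h a % 2                                 ≡⟨ gaussExponent-parity h b s m p≡ ⟩
    (b ℕ.* s ℕ.+ lowerCount b (suc (2 ℕ.* s))) % 2        ≡⟨ cong (λ t → (b ℕ.* s ℕ.+ lowerCount b t) % 2) r≡ ⟨
    (b ℕ.* s ℕ.+ lowerCount b r) % 2                      ≡⟨ odd ⟩
    1 ∎)
    where
    open ≡-Reasoning
    a = suc b
    r = p % (4 ℕ.* a)
    s = r / 2
    m = p / (4 ℕ.* a)
    r≡ : r ≡ suc (2 ℕ.* s)
    r≡ = trans (m≡m%n+[m/n]*n r 2) (trans (cong (ℕ._+ s ℕ.* 2) (p%4a%2≡1 b)) (cong suc (ℕ.*-comm s 2)))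
    p≡ : p ≡ suc (2 ℕ.* s) ℕ.+ m ℕ.* (4 ℕ.* a)
    p≡ = trans (m≡m%n+[m/n]*n p (4 ℕ.* a)) (cong (ℕ._+ m ℕ.* (4 ℕ.* a)) r≡)

  square-quarter : ∀ {c} → IsSquare (+ 4 * c) → IsSquare c
  square-quarter {c} (w , ww≈4c) = w * + suc h , (begin
    w * + suc h * (w * + suc h)         ≡⟨ regroup w (+ suc h) ⟩
    w * w * (+ suc h * + suc h)         ≈⟨ *-congʳ (+ suc h * + suc h) ww≈4c ⟩
    + 4 * c * (+ suc h * + suc h)       ≡⟨ regroup′ c (+ suc h) ⟩
    c * ((+ 2 * + suc h) * (+ 2 * + suc h)) ≡⟨ cong (λ t → c * (t * t)) 2[h+1]≡p+1 ⟩
    c * ((+ p + + 1) * (+ p + + 1))     ≈⟨ *-congˡ c (*-cong p+1≈1 p+1≈1) ⟩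
    c * (+ 1 * + 1)                     ≡⟨ ℤ.*-identityʳ c ⟩
    c ∎)
    where
    open ≈-Reasoning
    regroup : ∀ w k → w * k * (w * k) ≡ w * w * (k * k)
    regroup = solve-∀
    regroup′ : ∀ c k → + 4 * c * (k * k) ≡ c * ((+ 2 * k) * (+ 2 * k))
    regroup′ = solve-∀
    2[h+1]≡p+1 : + 2 * + suc h ≡ + p + + 1
    2[h+1]≡p+1 = trans (sym (ℤ.pos-* 2 (suc h))) (trans (cong +_ (double-suc h)) (ℤ.pos-+ p 1))
      where double-suc : ∀ h → 2 ℕ.* suc h ≡ suc (2 ℕ.* h) ℕ.+ 1
            double-suc = ℕ-Solver.solve-∀
    p+1≈1 : + p + + 1 ≈ + 1
    p+1≈1 = +-cong p≈0 (≈-refl {+ 1})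

  nonsquare-by-table : ∀ b {P} → ResidueTable b P → ¬ p ℕ.∣ suc b → P (p % (4 ℕ.* suc b)) → ¬ IsSquare (+ suc b)
  nonsquare-by-table b {P} table p∤a P[r] = nonsquare-by-residue b p∤a
    (subst (NonresidueClass b) toℕ-r (table r (subst (λ t → t % 2 ≡ 1) (sym toℕ-r) (p%4a%2≡1 b)) (subst P (sym toℕ-r) P[r])))
    where
    r = fromℕ< (m%n<n p (4 ℕ.* suc b))
    toℕ-r = Fin.toℕ-fromℕ< (m%n<n p (4 ℕ.* suc b))

  p∤prime : ∀ {q} → Prime q → p ≢ q → ¬ p ℕ.∣ q
  p∤prime q-prime p≢q p∣q with prime⇒irreducible q-prime p∣q
  ... | inj₁ p≡1 = ¬prime[1] (subst Prime p≡1 p-prime)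
  ... | inj₂ p≡q = p≢q p≡q

  nonsquare-2 : p % 8 ≡ 3 ⊎ p % 8 ≡ 5 → ¬ IsSquare (+ 2)
  nonsquare-2 = nonsquare-by-table 1 {λ r → r ≡ 3 ⊎ r ≡ 5} (from-yes (residueTable? 1 (λ r → (r ≟ 3) ⊎-dec (r ≟ 5))))
    (p∤prime prime[2] (λ p≡2 → contradiction (trans (cong (_% 2) (sym p≡2)) p%2≡1) λ ()))

  nonsquare-by-prime-table : ∀ b {Q : ℕ → Set} → Prime (suc b) → ¬ Q 0 →
    ResidueTable b (λ r → Q (r % suc b)) → Q (p % suc b) → ¬ IsSquare (+ suc b)
  nonsquare-by-prime-table b {Q} a-prime ¬Q0 table Q[p%a] = nonsquare-by-table b {λ r → Q (r % suc b)} table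
    (p∤prime a-prime (λ p≡a → ¬Q0 (subst Q (trans (cong (_% suc b) p≡a) (n%n≡0 (suc b))) Q[p%a])))
    (subst Q (sym (m∣n⇒o%n%m≡o%m (suc b) (4 ℕ.* suc b) p (ℕ.divides 4 refl))) Q[p%a])

  nonsquare-5 : p % 5 ≡ 2 ⊎ p % 5 ≡ 3 → ¬ IsSquare (+ 5)
  nonsquare-5 = nonsquare-by-prime-table 4 {λ x → x ≡ 2 ⊎ x ≡ 3} (from-yes (prime? 5)) (from-no (Q? 0))
                                         (from-yes (residueTable? 4 (Q? ∘ (_% 5))))
    where Q? : Decidable (λ x → x ≡ 2 ⊎ x ≡ 3)
          Q? x = (x ≟ 2) ⊎-dec (x ≟ 3)

  nonsquare-13 : p % 13 ≡ 2 ⊎ p % 13 ≡ 11 ⊎ p % 13 ≡ 5 ⊎ p % 13 ≡ 8 ⊎ p % 13 ≡ 6 ⊎ p % 13 ≡ 7 → ¬ IsSquare (+ 13)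
  nonsquare-13 = nonsquare-by-prime-table 12 {λ x → x ≡ 2 ⊎ x ≡ 11 ⊎ x ≡ 5 ⊎ x ≡ 8 ⊎ x ≡ 6 ⊎ x ≡ 7}
                   (from-yes (prime? 13)) (from-no (Q? 0)) (from-yes (residueTable? 12 (Q? ∘ (_% 13))))
    where Q? : Decidable (λ x → x ≡ 2 ⊎ x ≡ 11 ⊎ x ≡ 5 ⊎ x ≡ 8 ⊎ x ≡ 6 ⊎ x ≡ 7)
          Q? x = (x ≟ 2) ⊎-dec (x ≟ 11) ⊎-dec (x ≟ 5) ⊎-dec (x ≟ 8) ⊎-dec (x ≟ 6) ⊎-dec (x ≟ 7)

module _ {p : ℕ} (p-prime : Prime p) where
  open Modular p

  nonsquare⇒minimal-irreducible : ∀ {u} → ¬ IsSquare (u * u + + 4) → MinimalIrreducible p u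
  nonsquare⇒minimal-irreducible {u} ¬square = minimal-irreducible p-prime (nonsquare⇒¬RootAmongPowers {u = u} ¬square)

  double-root⇒minimal-irreducible : ∀ u e → True (≈-dec (u * u + + 4) (+ 0)) → False (≈-dec u (+ 0)) →
    True (≈±1-dec ((- u) ^ e)) → False (≈±1-dec ((+ 2) ^ e)) → MinimalIrreducible p u
  double-root⇒minimal-irreducible u e Δ≈0 u≉0 [-u]ᵉ≈±1 2ᵉ≉±1 = minimal-irreducible p-prime
    (discriminant≈0⇒¬RootAmongPowers p-prime (toWitness Δ≈0) (toWitnessFalse u≉0)
                                             e (toWitness [-u]ᵉ≈±1) (toWitnessFalse 2ᵉ≉±1))

odd⇒≡1+2h : ∀ {p} → p % 2 ≡ 1 → ∃[ h ] p ≡ suc (2 ℕ.* h)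
odd⇒≡1+2h {p} p%2≡1 =
  p / 2 , trans (m≡m%n+[m/n]*n p 2) (trans (cong (ℕ._+ p / 2 ℕ.* 2) p%2≡1) (cong suc (ℕ.*-comm (p / 2) 2)))

minimal-irreducible-±2 : ∀ {p} → Prime p → p % 2 ≡ 1 → (p % 8 ≡ 3 ⊎ p % 8 ≡ 5) →
  MinimalIrreducible p (+ 2) × MinimalIrreducible p (- (+ 2))
minimal-irreducible-±2 {p} p-prime p%2≡1 p%8 with odd⇒≡1+2h {p} p%2≡1
... | h , refl = nonsquare⇒minimal-irreducible p-prime ¬square , nonsquare⇒minimal-irreducible p-prime ¬square
  where open GaussLemma h p-prime
        ¬square = nonsquare-2 p%8 ∘ square-quarter

minimal-irreducible-±3 : ∀ {p} → Prime p → p % 2 ≡ 1 →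
  (p ≡ 13 ⊎ p % 13 ≡ 2 ⊎ p % 13 ≡ 11 ⊎ p % 13 ≡ 5 ⊎ p % 13 ≡ 8 ⊎ p % 13 ≡ 6 ⊎ p % 13 ≡ 7) →
  MinimalIrreducible p (+ 3) × MinimalIrreducible p (- (+ 3))
minimal-irreducible-±3 p-prime _ (inj₁ refl) =
  double-root⇒minimal-irreducible p-prime (+ 3) 3 _ _ _ _ , double-root⇒minimal-irreducible p-prime (- (+ 3)) 3 _ _ _ _
minimal-irreducible-±3 {p} p-prime p%2≡1 (inj₂ p%13) with odd⇒≡1+2h {p} p%2≡1
... | h , refl = nonsquare⇒minimal-irreducible p-prime ¬square , nonsquare⇒minimal-irreducible p-prime ¬square
  where ¬square = GaussLemma.nonsquare-13 h p-prime p%13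

minimal-irreducible-±4 : ∀ {p} → Prime p → p % 2 ≡ 1 → (p ≡ 5 ⊎ p % 5 ≡ 2 ⊎ p % 5 ≡ 3) →
  MinimalIrreducible p (+ 4) × MinimalIrreducible p (- (+ 4))
minimal-irreducible-±4 p-prime _ (inj₁ refl) =
  double-root⇒minimal-irreducible p-prime (+ 4) 1 _ _ _ _ , double-root⇒minimal-irreducible p-prime (- (+ 4)) 1 _ _ _ _
minimal-irreducible-±4 {p} p-prime p%2≡1 (inj₂ p%5) with odd⇒≡1+2h {p} p%2≡1
... | h , refl = nonsquare⇒minimal-irreducible p-prime ¬square , nonsquare⇒minimal-irreducible p-prime ¬square
  where open GaussLemma h p-prime
        ¬square = nonsquare-5 p%5 ∘ square-quarter

proposition6p6 : (p : ℕ) → Prime p → p % 2 ≡ 1 → p ≢ 3 →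
    ((p % 8 ≡ 3 ⊎ p % 8 ≡ 5) →
       MinimalIrreducible p (+ 2) × MinimalIrreducible p (- (+ 2)))
    × ((p ≡ 13 ⊎ p % 13 ≡ 2 ⊎ p % 13 ≡ 11 ⊎ p % 13 ≡ 5 ⊎ p % 13 ≡ 8
          ⊎ p % 13 ≡ 6 ⊎ p % 13 ≡ 7) →
       MinimalIrreducible p (+ 3) × MinimalIrreducible p (- (+ 3)))
    × ((p ≡ 5 ⊎ p % 5 ≡ 2 ⊎ p % 5 ≡ 3) →
       MinimalIrreducible p (+ 4) × MinimalIrreducible p (- (+ 4)))
proposition6p6 p p-prime p%2≡1 _ =
  minimal-irreducible-±2 p-prime p%2≡1 , minimal-irreducible-±3 p-prime p%2≡1 , minimal-irreducible-±4 p-prime p%2≡1
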